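{- Let $W$ be the dihedral Coxeter group $I_2(m)$ ($m\geq2$) and $k$ a positive integer. For any Coxeter element $c$, the multi-cluster complex $\Delta^k_c(I_2(m))$ is isomorphic to the boundary complex of a $2k$-dimensional cyclic polytope on $2k+m$ vertices.
   Context: $I_2(m)$ is generated by $S=\{a,b\}$ with $a^2=b^2=(ab)^m=1$; its longest element $w_\circ$ has length $m$. For a Coxeter element $c$ with reduced word $\mathbf{c}$, $\mathbf{w}_\circ(\mathbf{c})$ is the lexicographically first (as a sequence of positions) subword of $\mathbf{c}\mathbf{c}\cdots$ which is a reduced expression for $w_\circ$; the multi-cluster complex is the subword complex $\Delta^k_c(W)=\Delta(\mathbf{c}^k\mathbf{w}_\circ(\mathbf{c}),w_\circ)$, where for a word $Q$ and $\pi\in W$, $\Delta(Q,\pi)$ is the simplicial complex on the positions of $Q$ whose faces are the sets $P$ of positions such that deleting them leaves a word containing a reduced expression for $\pi$ as a subword. -}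

module Defs where

open import Data.Nat as ℕ using (ℕ; zero; suc; _+_; _∸_; _%_)
open import Data.Nat.DivMod using (m%n<n)
open import Data.Bool using (Bool; true; false; not)
open import Data.Product using (Σ; ∃; _×_; _,_)
open import Data.Sum using (_⊎_)
open import Data.List using (List; []; _∷_; length; map; concat; replicate)
import Data.List as L
open import Data.List.Relation.Unary.Linked using (Linked)
open import Data.Fin using (Fin; toℕ; fromℕ<)
open import Data.Fin.Subset using (Subset; _∈_; _⊆_; ∁; ⊤)
open import Data.Vec using (Vec; []; _∷_; tabulate; lookup)
open import Data.Integer using (+_)
open import Data.Rational using (ℚ; _/_; _≤_; 0ℚ)
import Data.Rational as Q
open import Function.Bundles using (_↔_; Inverse)
open import Relation.Binary.PropositionalEquality using (_≡_; _≢_)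

-- The dihedral group I₂(m), concretely.
-- Generators a = s, b = s r; an element s^f r^i is represented by
-- (f , i) with i < m (rotation exponent reduced mod m).

data Gen : Set where
  𝐚 𝐛 : Gen

Word : Set
Word = List Gen

Elem : Set
Elem = Bool × ℕ

-- x mod m (with the convention x mod 0 = x; only m ≥ 2 is ever used)
modN : ℕ → ℕ → ℕ
modN zero    x = x
modN (suc n) x = x % suc n

act : ℕ → Gen → Elem → Elem
act m 𝐚 (f , i)     = (not f , i)
act m 𝐛 (false , i) = (true , modN m (suc i))
act m 𝐛 (true , i)  = (false , modN m (i + m ∸ 1))

eval : ℕ → Word → Elem
eval m []      = (false , 0)
eval m (x ∷ w) = act m x (eval m w)

Reduced : ℕ → Word → Elem → Set
Reduced m w g = eval m w ≡ g × (∀ w' → eval m w' ≡ g → length w ℕ.≤ length w')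

alt : ℕ → Word
alt zero          = []
alt (suc zero)    = 𝐚 ∷ []
alt (suc (suc n)) = 𝐚 ∷ 𝐛 ∷ alt n

w∘ : ℕ → Elem
w∘ m = eval m (alt m)

IsCoxeterElement : ℕ → Elem → Set
IsCoxeterElement m c = c ≡ eval m (𝐚 ∷ 𝐛 ∷ []) ⊎ c ≡ eval m (𝐛 ∷ 𝐚 ∷ [])

-- w∘(c): lexicographically first subword of c c c ⋯ that is a reduced
-- expression for w∘.  Subwords of the infinite word are given by strictly
-- increasing lists of positions (ℕ).

cyc : Word → ℕ → Gen
cyc []       i = 𝐚   -- never used (Coxeter words are nonempty)
cyc (x ∷ xs) i = L.lookup (x ∷ xs) (fromℕ< (m%n<n i (suc (length xs))))

data LexLt : List ℕ → List ℕ → Set where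
  halt  : ∀ {y ys} → LexLt [] (y ∷ ys)
  here  : ∀ {x y xs ys} → x ℕ.< y → LexLt (x ∷ xs) (y ∷ ys)
  there : ∀ {x xs ys} → LexLt xs ys → LexLt (x ∷ xs) (x ∷ ys)

ValidW∘Pos : ℕ → Word → List ℕ → Set
ValidW∘Pos m cw ps = Linked ℕ._<_ ps × Reduced m (map (cyc cw) ps) (w∘ m)

IsW∘cPos : ℕ → Word → List ℕ → Set
IsW∘cPos m cw ps =
  ValidW∘Pos m cw ps × (∀ qs → ValidW∘Pos m cw qs → ps ≡ qs ⊎ LexLt ps qs)

sub : ∀ {A : Set} (w : List A) → Subset (length w) → List A
sub []      []          = []
sub (x ∷ w) (true ∷ R)  = x ∷ sub w R
sub (x ∷ w) (false ∷ R) = sub w R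

SubwordFace : ℕ → (Q : Word) → Elem → Subset (length Q) → Set
SubwordFace m Q π P = ∃ λ R → R ⊆ ∁ P × Reduced m (sub Q R) π

multiClusterWord : ℕ → Word → List ℕ → Word
multiClusterWord k cw ps = concat (replicate k cw) L.++ map (cyc cw) ps

-- Boundary complex of the cyclic polytope C(n, d) ⊂ ℚ^d:
-- convex hull of the points v_i = (t, t², …, t^d), t = i + 1, i < n,
-- on the moment curve.

sumFin : ∀ d → (Fin d → ℚ) → ℚ
sumFin zero    f = 0ℚ
sumFin (suc d) f = f Fin.zero Q.+ sumFin d (λ j → f (Fin.suc j))
  where import Data.Fin as Fin

momentCoord : ∀ {n d} → Fin n → Fin d → ℚ
momentCoord i j = (+ (suc (toℕ i) ℕ.^ suc (toℕ j))) / 1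

pairing : ∀ {n d} → (Fin d → ℚ) → Fin n → ℚ
pairing {n} {d} h i = sumFin d (λ j → h j Q.* momentCoord {n} {d} i j)

IsPolytopeFace : (d n : ℕ) → Subset n → Set
IsPolytopeFace d n F =
  Σ (Fin d → ℚ) λ h → Σ ℚ λ β →
    (∀ i → pairing {n} {d} h i ≤ β) ×
    (∀ i → (i ∈ F → pairing {n} {d} h i ≡ β) × (pairing {n} {d} h i ≡ β → i ∈ F))

CyclicBoundaryFace : (d n : ℕ) → Subset n → Set
CyclicBoundaryFace d n F = IsPolytopeFace d n F × F ≢ ⊤

image : ∀ {n₁ n₂} → Fin n₁ ↔ Fin n₂ → Subset n₁ → Subset n₂
image f P = tabulate (λ j → lookup P (Inverse.from f j))

SCIso : ∀ {n₁ n₂} → (Subset n₁ → Set) → (Subset n₂ → Set) → Set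
SCIso {n₁} {n₂} Δ₁ Δ₂ =
  Σ (Fin n₁ ↔ Fin n₂) λ f → ∀ P → (Δ₁ P → Δ₂ (image f P)) × (Δ₂ (image f P) → Δ₁ P)

-- The Cayley graph of I₂(m) is a 2m-cycle, so a word represents w∘ with minimal length
-- exactly when it has m letters and no two equal adjacent letters. For a Coxeter word
-- c = xy the word c^k w∘(c) is the alternating word of length n = 2k + m; hence a set P of
-- its positions is a face of the multi-cluster complex iff the letters outside P contain an
-- alternating subword of length m, i.e. iff they form at least m runs of equal letters.
--
-- On the other side, P is a face of the cyclic polytope C(n, 2k) iff it is the zero set,
-- among the parameters 1, …, n of the moment curve, of a polynomial of degree ≤ 2k that is
-- nonnegative there. With at least m runs, the product of the linear factors at P (doubling
-- one root inside every odd stretch of P between equal letters) has degree n − runs ≤ 2k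
-- and constant sign off P. With fewer runs, multiplying a separating polynomial by one
-- linear factor at each change of letter gives a polynomial of degree < n − 1 whose values
-- at 1, …, n weakly alternate in sign; its (n − 1)-st finite difference is 0 and is a sum of
-- terms of one sign, so all those values vanish, which is impossible off P.

module Submission where

module Dihedral where

  open import Defs using (Gen; 𝐚; 𝐛; Word; Elem; act; eval; Reduced; alt; w∘; IsCoxeterElement)
  open import Data.Nat using (ℕ; zero; suc; _+_; _∸_; _≤_; _<_; z≤n; s≤s; pred; _≟_)
  open import Data.Nat.Properties
  open import Data.Nat.DivMod using (m%n<n; m<n⇒m%n≡m; [m+n]%n≡m%n; n%n≡0)
  open import Data.Bool using (Bool; true; false; not; if_then_else_; _xor_)
  open import Data.Bool.Properties using (not-involutive; not-distribˡ-xor; not-distribʳ-xor; xor-identityʳ)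
  open import Data.Maybe using (Maybe; just; nothing)
  open import Data.Maybe.Properties using (just-injective)
  open import Data.Product using (Σ; _×_; _,_; proj₁; proj₂)
  open import Data.Sum using (_⊎_; inj₁; inj₂)
  open import Data.List using ([]; _∷_; length)
  open import Data.Unit using (⊤; tt)
  open import Data.Empty using (⊥; ⊥-elim)
  open import Relation.Nullary using (Dec; yes; no)
  open import Relation.Binary.PropositionalEquality

  other : Gen → Gen
  other 𝐚 = 𝐛
  other 𝐛 = 𝐚

  other-involutive : ∀ x → other (other x) ≡ x
  other-involutive 𝐚 = refl
  other-involutive 𝐛 = refl

  alternating : Gen → ℕ → Word
  alternating x zero    = []
  alternating x (suc n) = x ∷ alternating (other x) n

  length-alternating : ∀ x n → length (alternating x n) ≡ n
  length-alternating x zero    = refl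
  length-alternating x (suc n) = cong suc (length-alternating (other x) n)

  alt≡alternating : ∀ n → alt n ≡ alternating 𝐚 n
  alt≡alternating zero          = refl
  alt≡alternating (suc zero)    = refl
  alt≡alternating (suc (suc n)) = cong (λ w → 𝐚 ∷ 𝐛 ∷ w) (alt≡alternating n)

  double : ℕ → ℕ
  double zero    = zero
  double (suc n) = suc (suc (double n))

  isEven : ℕ → Bool
  isEven zero    = true
  isEven (suc n) = not (isEven n)

  isEven-double : ∀ n → isEven (double n) ≡ true
  isEven-double zero    = refl
  isEven-double (suc n) rewrite not-involutive (isEven (double n)) = isEven-double n

  double-injective : ∀ i j → double i ≡ double j → i ≡ j
  double-injective zero    zero    _  = refl
  double-injective (suc i) (suc j) eq = cong suc (double-injective i j (suc-injective (suc-injective eq)))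

  double≢suc-double : ∀ i j → double i ≢ suc (double j)
  double≢suc-double i j eq with trans (sym (isEven-double i)) (trans (cong isEven eq) (cong not (isEven-double j)))
  ... | ()

  double≡n+n : ∀ n → double n ≡ n + n
  double≡n+n zero    = refl
  double≡n+n (suc n) = cong suc (trans (cong suc (double≡n+n n)) (sym (+-suc n n)))

  double-mono-≤ : ∀ {i j} → i ≤ j → double i ≤ double j
  double-mono-≤ z≤n     = z≤n
  double-mono-≤ (s≤s p) = s≤s (s≤s (double-mono-≤ p))

  m<double : ∀ {m} → 0 < m → m < double m
  m<double {m} 0<m = subst (m <_) (sym (double≡n+n m)) (m<m+n m 0<m)

  -- The Cayley graph of I₂(m) with respect to {a, b} is a cycle of length 2m;
  -- `position` numbers its vertices 0, …, 2m − 1 starting at the identity, so that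
  -- left multiplication by a generator moves one step along the cycle.
  module _ (m : ℕ) where

    next : ℕ → ℕ
    next p with suc p ≟ double m
    ... | yes _ = 0
    ... | no  _ = suc p

    prev : ℕ → ℕ
    prev zero    = pred (double m)
    prev (suc p) = p

    step : Gen → ℕ → ℕ
    step 𝐚 p = if isEven p then prev p else next p
    step 𝐛 p = if isEven p then next p else prev p

    walk : Word → ℕ
    walk []      = 0
    walk (x ∷ w) = step x (walk w)

    position : Elem → ℕ
    position (false , i)     = double i
    position (true  , zero)  = pred (double m)
    position (true  , suc i) = suc (double i)

  next-wrap : ∀ m p → suc p ≡ double m → next m p ≡ 0
  next-wrap m p eq with suc p ≟ double m
  ... | yes _ = refl
  ... | no ne = ⊥-elim (ne eq)

  next-suc : ∀ m p → suc p ≢ double m → next m p ≡ suc p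
  next-suc m p ne with suc p ≟ double m
  ... | yes eq = ⊥-elim (ne eq)
  ... | no _   = refl

  next-below : ∀ m p → suc p < double m → next m p ≡ suc p
  next-below m p lt = next-suc m p (λ eq → <-irrefl eq lt)

  eval-bounded : ∀ m → 0 < m → ∀ w → proj₂ (eval m w) < m
  eval-bounded (suc m) _ [] = s≤s z≤n
  eval-bounded (suc m) 0<m (𝐚 ∷ w) = eval-bounded (suc m) 0<m w
  eval-bounded (suc m) _ (𝐛 ∷ w) with eval (suc m) w
  ... | false , i = m%n<n (suc i) (suc m)
  ... | true  , i = m%n<n (i + suc m ∸ 1) (suc m)

  position-act : ∀ m x f i → i < m → position m (act m x (f , i)) ≡ step m x (position m (f , i))
  position-act (suc m) 𝐚 false zero    _ = refl
  position-act (suc m) 𝐚 false (suc i) _ rewrite not-involutive (isEven (double i)) | isEven-double i = refl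
  position-act (suc m) 𝐚 true  zero    _ rewrite isEven-double m = sym (next-wrap (suc m) (suc (double m)) refl)
  position-act (suc m) 𝐚 true  (suc i) (s≤s i<m) rewrite isEven-double i =
    sym (next-below (suc m) (suc (double i)) (s≤s (s≤s (≤-trans (n≤1+n _) (double-mono-≤ i<m)))))
  position-act (suc m) 𝐛 false i (s≤s i≤m) rewrite isEven-double i
    | next-suc (suc m) (double i) (λ eq → double≢suc-double (suc m) i (sym eq)) with m≤n⇒m<n∨m≡n i≤m
  ... | inj₁ i<m  rewrite m<n⇒m%n≡m {n = suc m} (s≤s i<m) = refl
  ... | inj₂ refl rewrite n%n≡0 (suc i) ⦃ _ ⦄ = refl
  position-act (suc m) 𝐛 true zero _ rewrite isEven-double m | m<n⇒m%n≡m {n = suc m} (n<1+n m) = refl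
  position-act (suc m) 𝐛 true (suc i) (s≤s i<m) rewrite isEven-double i | +-suc i m
    | sym (+-suc i m) | [m+n]%n≡m%n i (suc m) ⦃ _ ⦄ | m<n⇒m%n≡m {n = suc m} (m≤n⇒m≤1+n i<m) = refl

  position-eval : ∀ m → 0 < m → ∀ w → position m (eval m w) ≡ walk m w
  position-eval m _ [] = refl
  position-eval m 0<m (x ∷ w) with eval m w | eval-bounded m 0<m w | position-eval m 0<m w
  ... | f , i | i<m | eq = trans (position-act m x f i i<m) (cong (step m x) eq)

  position-injective : ∀ m f i g j → i < m → j < m → position m (f , i) ≡ position m (g , j) → (f , i) ≡ (g , j)
  position-injective (suc m) false i       false j       _ _ eq = cong (false ,_) (double-injective i j eq)
  position-injective (suc m) false i       true  zero    _ _ eq = ⊥-elim (double≢suc-double i m eq)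
  position-injective (suc m) false i       true  (suc j) _ _ eq = ⊥-elim (double≢suc-double i j eq)
  position-injective (suc m) true  zero    false j       _ _ eq = ⊥-elim (double≢suc-double j m (sym eq))
  position-injective (suc m) true  (suc i) false j       _ _ eq = ⊥-elim (double≢suc-double j i (sym eq))
  position-injective (suc m) true  zero    true  zero    _ _ eq = refl
  position-injective (suc m) true  zero    true  (suc j) _ (s≤s j<m) eq =
    ⊥-elim (<-irrefl (sym (double-injective m j (suc-injective eq))) j<m)
  position-injective (suc m) true  (suc i) true  zero    (s≤s i<m) _ eq =
    ⊥-elim (<-irrefl (double-injective i m (suc-injective eq)) i<m)
  position-injective (suc m) true  (suc i) true  (suc j) _ _ eq =
    cong (λ k → true , suc k) (double-injective i j (suc-injective eq))

  position-bounded : ∀ m f i → i < m → position m (f , i) < double m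
  position-bounded (suc m) false i       (s≤s i≤m) = s≤s (≤-trans (n≤1+n (double i)) (s≤s (double-mono-≤ i≤m)))
  position-bounded (suc m) true  zero    _         = n<1+n (suc (double m))
  position-bounded (suc m) true  (suc i) (s≤s i<m) = s≤s (s≤s (double-mono-≤ (<⇒≤ i<m)))

  walk-bounded : ∀ m → 0 < m → ∀ w → walk m w < double m
  walk-bounded m 0<m w with eval m w | eval-bounded m 0<m w | position-eval m 0<m w
  ... | f , i | i<m | eq = subst (_< double m) eq (position-bounded m f i i<m)

  eval≡⇒walk≡ : ∀ m → 0 < m → ∀ w u → eval m w ≡ eval m u → walk m w ≡ walk m u
  eval≡⇒walk≡ m 0<m w u eq =
    trans (sym (position-eval m 0<m w)) (trans (cong (position m) eq) (position-eval m 0<m u))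

  isEven-next : ∀ m p → isEven (next m p) ≡ not (isEven p)
  isEven-next m p with suc p ≟ double m
  ... | yes eq = sym (trans (cong isEven eq) (isEven-double m))
  ... | no _   = refl

  isEven-prev : ∀ m p → 0 < m → isEven (prev m p) ≡ not (isEven p)
  isEven-prev (suc m) zero    _ rewrite isEven-double m = refl
  isEven-prev m       (suc p) _ = sym (not-involutive (isEven p))

  next-prev : ∀ m p → 0 < m → p < double m → next m (prev m p) ≡ p
  next-prev (suc m) zero    _ _    = next-wrap (suc m) (suc (double m)) refl
  next-prev m       (suc p) _ p<2m = next-below m p p<2m

  prev-next : ∀ m p → prev m (next m p) ≡ p
  prev-next m p with suc p ≟ double m
  ... | yes eq = cong pred (sym eq)
  ... | no _   = refl

  step-involutive : ∀ m x p → 0 < m → p < double m → step m x (step m x p) ≡ p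
  step-involutive m 𝐚 p 0<m p<2m with isEven p in e
  ... | true  rewrite isEven-prev m p 0<m | e = next-prev m p 0<m p<2m
  ... | false rewrite isEven-next m p | e = prev-next m p
  step-involutive m 𝐛 p 0<m p<2m with isEven p in e
  ... | true  rewrite isEven-next m p | e = prev-next m p
  ... | false rewrite isEven-prev m p 0<m | e = next-prev m p 0<m p<2m

  WithinReach : ℕ → ℕ → ℕ → Set
  WithinReach m n p = p ≤ n ⊎ double m ∸ p ≤ n

  ∸-suc-≤ : ∀ a p → a ∸ p ≤ suc (a ∸ suc p)
  ∸-suc-≤ zero    p       = subst (_≤ 1) (sym (0∸n≡0 p)) z≤n
  ∸-suc-≤ (suc a) zero    = ≤-refl
  ∸-suc-≤ (suc a) (suc p) = ∸-suc-≤ a p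

  reach-next : ∀ m n p → WithinReach m n p → WithinReach m (suc n) (next m p)
  reach-next m n p reach with suc p ≟ double m | reach
  ... | yes _ | _        = inj₁ z≤n
  ... | no _  | inj₁ p≤n = inj₁ (s≤s p≤n)
  ... | no _  | inj₂ d≤n = inj₂ (≤-trans (∸-monoʳ-≤ (double m) (n≤1+n p)) (m≤n⇒m≤1+n d≤n))

  reach-prev : ∀ m n p → 0 < m → WithinReach m n p → WithinReach m (suc n) (prev m p)
  reach-prev (suc m) n zero    _ _        = inj₂ (≤-trans (≤-reflexive (m+n∸n≡m 1 (suc (double m)))) (s≤s z≤n))
  reach-prev m       n (suc p) _ (inj₁ p≤n) = inj₁ (≤-trans (n≤1+n p) (m≤n⇒m≤1+n p≤n))
  reach-prev m       n (suc p) _ (inj₂ d≤n) = inj₂ (≤-trans (∸-suc-≤ (double m) p) (s≤s d≤n))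

  reach-step : ∀ m x n p → 0 < m → WithinReach m n p → WithinReach m (suc n) (step m x p)
  reach-step m 𝐚 n p 0<m reach with isEven p
  ... | true  = reach-prev m n p 0<m reach
  ... | false = reach-next m n p reach
  reach-step m 𝐛 n p 0<m reach with isEven p
  ... | true  = reach-next m n p reach
  ... | false = reach-prev m n p 0<m reach

  walk-reach : ∀ m → 0 < m → ∀ w → WithinReach m (length w) (walk m w)
  walk-reach m 0<m []      = inj₁ z≤n
  walk-reach m 0<m (x ∷ w) = reach-step m x (length w) (walk m w) 0<m (walk-reach m 0<m w)

  -- The antipode m of the origin is m steps away in both directions.
  walk≡m⇒m≤length : ∀ m → 0 < m → ∀ w → walk m w ≡ m → m ≤ length w
  walk≡m⇒m≤length m 0<m w eq with walk-reach m 0<m w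
  ... | inj₁ le = subst (_≤ length w) eq le
  ... | inj₂ le = subst (_≤ length w) antipode le
    where
    antipode : double m ∸ walk m w ≡ m
    antipode = begin
      double m ∸ walk m w ≡⟨ cong₂ _∸_ (double≡n+n m) eq ⟩
      m + m ∸ m           ≡⟨ m+n∸n≡m m m ⟩
      m                   ∎
      where open ≡-Reasoning

  isEven-∸ : ∀ a j → j ≤ a → isEven (a ∸ j) ≡ not (isEven a xor isEven j)
  isEven-∸ a       zero    _         = sym (xor-true (isEven a))
    where
    xor-true : ∀ x → not (x xor true) ≡ x
    xor-true true  = refl
    xor-true false = refl
  isEven-∸ (suc a) (suc j) (s≤s j≤a) = trans (isEven-∸ a j j≤a) (cong not (sym (not-xor-not (isEven a) (isEven j))))
    where
    not-xor-not : ∀ x y → not x xor not y ≡ x xor y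
    not-xor-not true  y = refl
    not-xor-not false y = not-involutive y

  isEven-double∸ : ∀ m j → j ≤ double m → isEven (double m ∸ j) ≡ isEven j
  isEven-double∸ m j j≤2m rewrite isEven-∸ (double m) j j≤2m | isEven-double m = not-involutive (isEven j)

  isEven-+⇒xor : ∀ u c σ → isEven (u + c) ≡ σ → σ xor isEven (suc u) ≡ isEven c
  isEven-+⇒xor zero    c σ eq = trans (xor-identityʳ σ) (sym eq)
  isEven-+⇒xor (suc u) c σ eq = begin
    σ xor not (isEven (suc u))   ≡⟨ sym (not-distribʳ-xor σ (isEven (suc u))) ⟩
    not (σ xor isEven (suc u))   ≡⟨ not-distribˡ-xor σ (isEven (suc u)) ⟩
    not σ xor isEven (suc u)     ≡⟨ isEven-+⇒xor u c (not σ) (trans (sym (not-involutive _)) (cong not eq)) ⟩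
    isEven c                     ∎
    where open ≡-Reasoning

  prev-double∸ : ∀ m j → suc j ≤ double m → prev m (double m ∸ j) ≡ double m ∸ suc j
  prev-double∸ m j j<2m with double m ∸ j | m<n⇒0<n∸m j<2m | pred[m∸n]≡m∸[1+n] (double m) j
  ... | suc k | _ | eq = eq

  -- Whether the alternating word starting with x, of length L, walks forwards from the origin.
  forward : Gen → ℕ → Bool
  forward 𝐚 L = isEven L
  forward 𝐛 L = not (isEven L)

  walk-alternating : ∀ m x L → 1 ≤ L → L ≤ m →
    walk m (alternating x L) ≡ (if forward x L then L else double m ∸ L)
  walk-alternating (suc m) 𝐚 (suc zero) _ _ = refl
  walk-alternating (suc m) 𝐛 (suc zero) _ _ = refl
  walk-alternating m x (suc (suc L)) _ L+2≤m
    with walk-alternating m (other x) (suc L) (s≤s z≤n) (<⇒≤ L+2≤m)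
       | ≤-<-trans L+2≤m (m<double (≤-trans (s≤s z≤n) L+2≤m))
  walk-alternating m 𝐚 (suc (suc L)) _ _ | ih | L+2<2m with isEven L in e
  ... | true  rewrite ih | e = next-below m (suc L) L+2<2m
  ... | false rewrite ih | isEven-double∸ m (suc L) (<⇒≤ (<-trans (n<1+n _) L+2<2m)) | e =
    prev-double∸ m (suc L) (<⇒≤ L+2<2m)
  walk-alternating m 𝐛 (suc (suc L)) _ _ | ih | L+2<2m with isEven L in e
  ... | true  rewrite ih | isEven-double∸ m (suc L) (<⇒≤ (<-trans (n<1+n _) L+2<2m)) | e =
    prev-double∸ m (suc L) (<⇒≤ L+2<2m)
  ... | false rewrite ih | e = next-below m (suc L) L+2<2m

  walk-alternating-antipode : ∀ m x → 1 ≤ m → walk m (alternating x m) ≡ m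
  walk-alternating-antipode m x 1≤m with forward x m | walk-alternating m x m 1≤m ≤-refl
  ... | true  | eq = eq
  ... | false | eq = trans eq (trans (cong (_∸ m) (double≡n+n m)) (m+n∸n≡m m m))

  _≟-Gen_ : (x y : Gen) → Dec (x ≡ y)
  𝐚 ≟-Gen 𝐚 = yes refl
  𝐚 ≟-Gen 𝐛 = no λ ()
  𝐛 ≟-Gen 𝐚 = no λ ()
  𝐛 ≟-Gen 𝐛 = yes refl

  NoRepeat : Maybe Gen → Word → Set
  NoRepeat ℓ []      = ⊤
  NoRepeat ℓ (x ∷ w) = ℓ ≢ just x × NoRepeat (just x) w

  ≢⇒other : ∀ y x → just y ≢ just x → x ≡ other y
  ≢⇒other 𝐚 𝐚 ne = ⊥-elim (ne refl)
  ≢⇒other 𝐚 𝐛 _  = refl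
  ≢⇒other 𝐛 𝐚 _  = refl
  ≢⇒other 𝐛 𝐛 ne = ⊥-elim (ne refl)

  noRepeat-after⇒alternating : ∀ y w → NoRepeat (just y) w → w ≡ alternating (other y) (length w)
  noRepeat-after⇒alternating y []      _          = refl
  noRepeat-after⇒alternating y (x ∷ w) (y≢x , nr) with ≢⇒other y x y≢x
  ... | refl = cong (other y ∷_) (noRepeat-after⇒alternating (other y) w nr)

  noRepeat⇒alternating : ∀ w → NoRepeat nothing w → Σ Gen λ x → w ≡ alternating x (length w)
  noRepeat⇒alternating []      _        = 𝐚 , refl
  noRepeat⇒alternating (x ∷ w) (_ , nr) = x , cong (x ∷_) (noRepeat-after⇒alternating x w nr)

  alternating-noRepeat-after : ∀ x L → NoRepeat (just (other x)) (alternating x L)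
  alternating-noRepeat-after x   zero    = tt
  alternating-noRepeat-after 𝐚 (suc L) = (λ ()) , alternating-noRepeat-after 𝐛 L
  alternating-noRepeat-after 𝐛 (suc L) = (λ ()) , alternating-noRepeat-after 𝐚 L

  alternating-noRepeat : ∀ x L → NoRepeat nothing (alternating x L)
  alternating-noRepeat x zero    = tt
  alternating-noRepeat x (suc L) =
    (λ ()) , subst (λ y → NoRepeat (just y) (alternating (other x) L)) (other-involutive x)
                   (alternating-noRepeat-after (other x) L)

  position-w∘ : ∀ m → 1 ≤ m → position m (w∘ m) ≡ m
  position-w∘ m 1≤m = trans (position-eval m 1≤m (alt m))
    (trans (cong (walk m) (alt≡alternating m)) (walk-alternating-antipode m 𝐚 1≤m))

  walk≡m⇒eval≡w∘ : ∀ m → 1 ≤ m → ∀ w → walk m w ≡ m → eval m w ≡ w∘ m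
  walk≡m⇒eval≡w∘ m 1≤m w eq =
    position-injective m (proj₁ (eval m w)) (proj₂ (eval m w)) (proj₁ (w∘ m)) (proj₂ (w∘ m))
      (eval-bounded m 1≤m w) (eval-bounded m 1≤m (alt m))
      (trans (trans (position-eval m 1≤m w) eq) (sym (position-w∘ m 1≤m)))

  eval≡w∘⇒walk≡m : ∀ m → 1 ≤ m → ∀ w → eval m w ≡ w∘ m → walk m w ≡ m
  eval≡w∘⇒walk≡m m 1≤m w eq = trans (sym (position-eval m 1≤m w)) (trans (cong (position m) eq) (position-w∘ m 1≤m))

  length-alt : ∀ m → length (alt m) ≡ m
  length-alt m = trans (cong length (alt≡alternating m)) (length-alternating 𝐚 m)

  noRepeat-or-shorter : ∀ m → 0 < m → ∀ w →
    NoRepeat nothing w ⊎ Σ Word (λ u → walk m u ≡ walk m w × suc (suc (length u)) ≡ length w)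
  noRepeat-or-shorter m 0<m []          = inj₁ tt
  noRepeat-or-shorter m 0<m (x ∷ [])    = inj₁ ((λ ()) , tt)
  noRepeat-or-shorter m 0<m (x ∷ y ∷ w) with noRepeat-or-shorter m 0<m (y ∷ w)
  ... | inj₂ (u , same-walk , shorter) = inj₂ (x ∷ u , cong (step m x) same-walk , cong suc shorter)
  ... | inj₁ (_ , nr) with x ≟-Gen y
  ...   | yes refl = inj₂ (w , sym (step-involutive m x (walk m w) 0<m (walk-bounded m 0<m w)) , refl)
  ...   | no x≢y   = inj₁ ((λ ()) , (λ eq → x≢y (just-injective eq)) , nr)

  reduced-w∘⁺ : ∀ m → 1 ≤ m → ∀ w → NoRepeat nothing w → length w ≡ m → Reduced m w (w∘ m)
  reduced-w∘⁺ m 1≤m w nr len with noRepeat⇒alternating w nr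
  ... | x , w≡alt = walk≡m⇒eval≡w∘ m 1≤m w antipode , minimal
    where
    antipode : walk m w ≡ m
    antipode = trans (cong (walk m) w≡alt) (trans (cong (λ L → walk m (alternating x L)) len) (walk-alternating-antipode m x 1≤m))
    minimal : ∀ u → eval m u ≡ w∘ m → length w ≤ length u
    minimal u eq = subst (_≤ length u) (sym len) (walk≡m⇒m≤length m 1≤m u (eval≡w∘⇒walk≡m m 1≤m u eq))

  reduced-w∘⁻ : ∀ m → 1 ≤ m → ∀ w → Reduced m w (w∘ m) → length w ≡ m × NoRepeat nothing w
  reduced-w∘⁻ m 1≤m w (eq , minimal) with noRepeat-or-shorter m 1≤m w
  ... | inj₁ nr = len , nr
    where
    len : length w ≡ m
    len = ≤-antisym (subst (length w ≤_) (length-alt m) (minimal (alt m) refl))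
                    (walk≡m⇒m≤length m 1≤m w (eval≡w∘⇒walk≡m m 1≤m w eq))
  ... | inj₂ (u , same-walk , shorter) = ⊥-elim (<-irrefl refl (<-≤-trans u<w w≤u))
    where
    u<w : length u < length w
    u<w = subst (length u <_) shorter (m<n⇒m<1+n (n<1+n (length u)))
    w≤u : length w ≤ length u
    w≤u = minimal u (walk≡m⇒eval≡w∘ m 1≤m u (trans same-walk (eval≡w∘⇒walk≡m m 1≤m w eq)))

  walk-repeat : ∀ m x → 0 < m → walk m (x ∷ x ∷ []) ≡ 0
  walk-repeat m x 0<m = step-involutive m x 0 0<m (≤-<-trans z≤n (m<double 0<m))

  repeat-off-target : ∀ m′ x → let m = suc (suc m′) in
    walk m (x ∷ x ∷ []) ≡ 2 ⊎ walk m (x ∷ x ∷ []) ≡ double m ∸ 2 → ⊥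
  repeat-off-target m′ x (inj₁ eq) with trans (sym (walk-repeat (suc (suc m′)) x (s≤s z≤n))) eq
  ... | ()
  repeat-off-target m′ x (inj₂ eq) with trans (sym (walk-repeat (suc (suc m′)) x (s≤s z≤n))) eq
  ... | ()

  walk-two-letters : ∀ m′ cw → let m = suc (suc m′) in length cw ≤ 2 →
    walk m cw ≡ 2 ⊎ walk m cw ≡ double m ∸ 2 → cw ≡ 𝐚 ∷ 𝐛 ∷ [] ⊎ cw ≡ 𝐛 ∷ 𝐚 ∷ []
  walk-two-letters m′ []              _ (inj₁ ())
  walk-two-letters m′ []              _ (inj₂ ())
  walk-two-letters m′ (𝐚 ∷ [])        _ (inj₁ ())
  walk-two-letters m′ (𝐚 ∷ [])        _ (inj₂ eq) = ⊥-elim (1+n≢n eq)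
  walk-two-letters m′ (𝐛 ∷ [])        _ (inj₁ ())
  walk-two-letters m′ (𝐛 ∷ [])        _ (inj₂ ())
  walk-two-letters m′ (𝐚 ∷ 𝐛 ∷ [])    _ _ = inj₁ refl
  walk-two-letters m′ (𝐛 ∷ 𝐚 ∷ [])    _ _ = inj₂ refl
  walk-two-letters m′ (𝐚 ∷ 𝐚 ∷ [])    _ target = ⊥-elim (repeat-off-target m′ 𝐚 target)
  walk-two-letters m′ (𝐛 ∷ 𝐛 ∷ [])    _ target = ⊥-elim (repeat-off-target m′ 𝐛 target)
  walk-two-letters m′ (_ ∷ _ ∷ _ ∷ _) (s≤s (s≤s ())) _

  coxeterWord : ∀ m → 2 ≤ m → ∀ c → IsCoxeterElement m c → ∀ cw → Reduced m cw c →
    cw ≡ 𝐚 ∷ 𝐛 ∷ [] ⊎ cw ≡ 𝐛 ∷ 𝐚 ∷ []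
  coxeterWord (suc zero) (s≤s ()) _ _ _ _
  coxeterWord (suc (suc m′)) _ c (inj₁ refl) cw (eq , minimal) =
    walk-two-letters m′ cw (minimal (𝐚 ∷ 𝐛 ∷ []) refl) (inj₁ (eval≡⇒walk≡ _ (s≤s z≤n) cw (𝐚 ∷ 𝐛 ∷ []) eq))
  coxeterWord (suc (suc m′)) _ c (inj₂ refl) cw (eq , minimal) =
    walk-two-letters m′ cw (minimal (𝐛 ∷ 𝐚 ∷ []) refl)
      (inj₂ (trans (eval≡⇒walk≡ _ (s≤s z≤n) cw (𝐛 ∷ 𝐚 ∷ []) eq)
                   (walk-alternating _ 𝐛 2 (s≤s z≤n) (s≤s (s≤s z≤n)))))

module GreedySubwords where

  open import Defs using (Gen; 𝐚; 𝐛; Word; sub; SubwordFace; w∘)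
  open Dihedral using (NoRepeat; reduced-w∘⁺; reduced-w∘⁻)
  open import Data.Nat using (ℕ; zero; suc; _+_; _≤_; z≤n; s≤s)
  open import Data.Nat.Properties
  open import Data.Bool using (Bool; true; false; if_then_else_)
  open import Data.Maybe using (Maybe; just; nothing)
  open import Data.Product using (_×_; _,_)
  open import Data.List using ([]; _∷_; length)
  open import Data.Vec using ([]; _∷_; here)
  open import Data.Fin.Subset using (Subset; _⊆_; ∁)
  open import Data.Fin.Subset.Properties using (drop-∷-⊆; out⊆; s⊆s)
  open import Data.Unit using (tt)
  open import Data.Empty using (⊥-elim)
  open import Relation.Binary.PropositionalEquality

  _==_ : Gen → Gen → Bool
  𝐚 == 𝐚 = true
  𝐚 == 𝐛 = false
  𝐛 == 𝐚 = false
  𝐛 == 𝐛 = true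

  repeats : Maybe Gen → Gen → Bool
  repeats nothing  x = false
  repeats (just y) x = y == x

  repeats-true : ∀ ℓ x → repeats ℓ x ≡ true → ℓ ≡ just x
  repeats-true (just 𝐚) 𝐚 _ = refl
  repeats-true (just 𝐛) 𝐛 _ = refl

  repeats-false : ∀ ℓ x → repeats ℓ x ≡ false → ℓ ≢ just x
  repeats-false (just 𝐚) 𝐚 () refl
  repeats-false (just 𝐛) 𝐛 () refl

  repeats-distinct : ∀ x y → just x ≢ just y → repeats (just x) y ≡ false
  repeats-distinct 𝐚 𝐚 ne = ⊥-elim (ne refl)
  repeats-distinct 𝐚 𝐛 _  = refl
  repeats-distinct 𝐛 𝐚 _  = refl
  repeats-distinct 𝐛 𝐛 ne = ⊥-elim (ne refl)

  greedy : Maybe Gen → (Q : Word) → Subset (length Q) → ℕ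
  greedy ℓ []      []          = 0
  greedy ℓ (x ∷ Q) (true  ∷ P) = greedy ℓ Q P
  greedy ℓ (x ∷ Q) (false ∷ P) = if repeats ℓ x then greedy ℓ Q P else suc (greedy (just x) Q P)

  greedySubset : ℕ → Maybe Gen → (Q : Word) → Subset (length Q) → Subset (length Q)
  greedySubset b       ℓ []      []          = []
  greedySubset b       ℓ (x ∷ Q) (true  ∷ P) = false ∷ greedySubset b ℓ Q P
  greedySubset zero    ℓ (x ∷ Q) (false ∷ P) = false ∷ greedySubset zero ℓ Q P
  greedySubset (suc b) ℓ (x ∷ Q) (false ∷ P) =
    if repeats ℓ x then false ∷ greedySubset (suc b) ℓ Q P else true ∷ greedySubset b (just x) Q P

  greedySubset-correct : ∀ b ℓ Q P → b ≤ greedy ℓ Q P → let R = greedySubset b ℓ Q P in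
    R ⊆ ∁ P × length (sub Q R) ≡ b × NoRepeat ℓ (sub Q R)
  greedySubset-correct zero ℓ [] [] z≤n = (λ ()) , refl , tt
  greedySubset-correct (suc b) ℓ [] [] ()
  greedySubset-correct b ℓ (x ∷ Q) (true ∷ P) b≤g with greedySubset-correct b ℓ Q P b≤g
  ... | R⊆∁P , len , nr = out⊆ R⊆∁P , len , nr
  greedySubset-correct zero ℓ (x ∷ Q) (false ∷ P) _ with greedySubset-correct zero ℓ Q P z≤n
  ... | R⊆∁P , len , nr = out⊆ R⊆∁P , len , nr
  greedySubset-correct (suc b) ℓ (x ∷ Q) (false ∷ P) b≤g with repeats ℓ x in rep
  ... | true with greedySubset-correct (suc b) ℓ Q P b≤g
  ...   | R⊆∁P , len , nr = out⊆ R⊆∁P , len , nr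
  greedySubset-correct (suc b) ℓ (x ∷ Q) (false ∷ P) (s≤s b≤g) | false
    with greedySubset-correct b (just x) Q P b≤g
  ...   | R⊆∁P , len , nr = s⊆s R⊆∁P , cong suc len , repeats-false ℓ x rep , nr

  headRepeats : Maybe Gen → Word → ℕ
  headRepeats ℓ []      = 0
  headRepeats ℓ (x ∷ w) = if repeats ℓ x then 1 else 0

  headRepeats≤1 : ∀ ℓ w → headRepeats ℓ w ≤ 1
  headRepeats≤1 ℓ []      = z≤n
  headRepeats≤1 ℓ (x ∷ w) with repeats ℓ x
  ... | true  = s≤s z≤n
  ... | false = z≤n

  noRepeat-weaken : ∀ x w → NoRepeat (just x) w → NoRepeat nothing w
  noRepeat-weaken x []      _        = tt
  noRepeat-weaken x (y ∷ w) (_ , nr) = (λ ()) , nr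

  noRepeat⇒headRepeats≡0 : ∀ x w → NoRepeat (just x) w → headRepeats (just x) w ≡ 0
  noRepeat⇒headRepeats≡0 x []      _          = refl
  noRepeat⇒headRepeats≡0 x (y ∷ w) (x≢y , _) rewrite repeats-distinct x y x≢y = refl

  -- The headRepeats term covers a subword that begins with ℓ, a letter the scan would skip.
  greedy-maximal : ∀ ℓ Q P R → R ⊆ ∁ P → NoRepeat nothing (sub Q R) →
    length (sub Q R) ≤ greedy ℓ Q P + headRepeats ℓ (sub Q R)
  greedy-maximal ℓ [] [] [] _ _ = z≤n
  greedy-maximal ℓ (x ∷ Q) (true ∷ P) (true ∷ R) R⊆∁P _ with R⊆∁P here
  ... | ()
  greedy-maximal ℓ (x ∷ Q) (true ∷ P) (false ∷ R) R⊆∁P nr = greedy-maximal ℓ Q P R (drop-∷-⊆ R⊆∁P) nr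
  greedy-maximal ℓ (x ∷ Q) (false ∷ P) (true ∷ R) R⊆∁P (_ , nr)
    with repeats ℓ x in rep | greedy-maximal (just x) Q P R (drop-∷-⊆ R⊆∁P) (noRepeat-weaken x _ nr)
  ... | true  | ih rewrite repeats-true ℓ x rep | noRepeat⇒headRepeats≡0 x _ nr =
    subst (suc (length (sub Q R)) ≤_) (+-comm 1 _) (s≤s (subst (length (sub Q R) ≤_) (+-identityʳ _) ih))
  ... | false | ih rewrite noRepeat⇒headRepeats≡0 x _ nr = s≤s ih
  greedy-maximal ℓ (x ∷ Q) (false ∷ P) (false ∷ R) R⊆∁P nr with repeats ℓ x
  ... | true  = greedy-maximal ℓ Q P R (drop-∷-⊆ R⊆∁P) nr
  ... | false = ≤-trans (greedy-maximal (just x) Q P R (drop-∷-⊆ R⊆∁P) nr)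
                  (≤-trans (+-monoʳ-≤ (greedy (just x) Q P) (headRepeats≤1 (just x) (sub Q R)))
                    (≤-trans (≤-reflexive (+-comm (greedy (just x) Q P) 1)) (m≤m+n _ _)))

  headRepeats-nothing : ∀ w → headRepeats nothing w ≡ 0
  headRepeats-nothing []      = refl
  headRepeats-nothing (x ∷ w) = refl

  subwordFace⇒m≤greedy : ∀ m → 1 ≤ m → ∀ Q P → SubwordFace m Q (w∘ m) P → m ≤ greedy nothing Q P
  subwordFace⇒m≤greedy m 1≤m Q P (R , R⊆∁P , reduced) with reduced-w∘⁻ m 1≤m (sub Q R) reduced
  ... | len , nr rewrite sym len =
    subst (length (sub Q R) ≤_) (trans (cong (greedy nothing Q P +_) (headRepeats-nothing (sub Q R))) (+-identityʳ _))
          (greedy-maximal nothing Q P R R⊆∁P nr)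

  m≤greedy⇒subwordFace : ∀ m → 1 ≤ m → ∀ Q P → m ≤ greedy nothing Q P → SubwordFace m Q (w∘ m) P
  m≤greedy⇒subwordFace m 1≤m Q P m≤g with greedySubset-correct m nothing Q P m≤g
  ... | R⊆∁P , len , nr = greedySubset m nothing Q P , R⊆∁P , reduced-w∘⁺ m 1≤m _ nr len

module Polynomials where

  open import Defs using (momentCoord)
  open Dihedral using (isEven)
  open import Data.Nat as ℕ using (ℕ; zero; suc; z≤n; s≤s)
  import Data.Nat.Properties as ℕ
  import Data.Integer as ℤ
  import Data.Integer.Properties as ℤ
  open import Data.Nat.Coprimality using (1-coprimeTo) renaming (sym to coprime-sym)
  open import Data.Rational
  open import Data.Rational.Properties
  open import Data.Rational.Solver using (module +-*-Solver)
  open +-*-Solver using (solve; _:+_; _:*_; :-_; _:-_; _:=_; con)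
  open import Data.Bool using (Bool; true; false; not; if_then_else_; _xor_; T)
  open import Data.Bool.Properties using (not-involutive; not-distribʳ-xor)
  open import Data.Fin using (Fin; toℕ)
  open import Data.List using (List; []; _∷_; length)
  open import Data.List.Membership.Propositional using (_∈_)
  open import Data.List.Relation.Unary.Any using (here; there)
  open import Data.Product using (_×_; _,_; proj₁; proj₂)
  open import Data.Sum using (inj₁; inj₂)
  open import Data.Empty using (⊥-elim)
  open import Relation.Nullary using (¬_)
  open import Relation.Binary.Definitions using (tri<; tri≈; tri>)
  open import Relation.Binary.PropositionalEquality

  opaque
    ι : ℕ → ℚ
    ι n = ℤ.+ n / 1

    ι-normal : ∀ a → ℤ.+ a / 1 ≡ mkℚ (ℤ.+ a) 0 (coprime-sym (1-coprimeTo a))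
    ι-normal a = normalize-coprime (coprime-sym (1-coprimeTo a))

    ι-* : ∀ a b → ι a * ι b ≡ ι (a ℕ.* b)
    ι-* a b rewrite ι-normal a | ι-normal b = cong (_/ 1) (sym (ℤ.pos-* a b))

    ι-+ : ∀ a b → ι a + ι b ≡ ι (a ℕ.+ b)
    ι-+ a b rewrite ι-normal a | ι-normal b =
      cong (_/ 1) (trans (cong₂ ℤ._+_ (ℤ.*-identityʳ (ℤ.+ a)) (ℤ.*-identityʳ (ℤ.+ b))) (sym (ℤ.pos-+ a b)))

    ι-suc : ∀ a → ι (suc a) ≡ ι a + 1ℚ
    ι-suc a = trans (cong ι (ℕ.+-comm 1 a)) (sym (ι-+ a 1))

    momentCoord≡ι : ∀ {n d} (i : Fin n) (j : Fin d) → momentCoord {n} {d} i j ≡ ι (suc (toℕ i) ℕ.^ suc (toℕ j))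
    momentCoord≡ι i j = refl

  0<1 : 0ℚ < 1ℚ
  0<1 = positive⁻¹ 1ℚ

  ι-<-suc : ∀ a → ι a < ι (suc a)
  ι-<-suc a = subst (ι a <_) (sym (ι-suc a)) (subst (_< ι a + 1ℚ) (+-identityʳ (ι a)) (+-monoʳ-< (ι a) 0<1))

  ι-mono-< : ∀ {a b} → a ℕ.< b → ι a < ι b
  ι-mono-< {a} {suc b} (s≤s a≤b) with ℕ.m≤n⇒m<n∨m≡n a≤b
  ... | inj₁ a<b  = <-trans (ι-mono-< a<b) (ι-<-suc b)
  ... | inj₂ refl = ι-<-suc a

  p<q⇒0<q-p : ∀ {p q} → p < q → 0ℚ < q - p
  p<q⇒0<q-p {p} {q} p<q = subst (_< q - p) (+-inverseʳ p) (+-monoˡ-< (- p) p<q)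

  p<q⇒p-q<0 : ∀ {p q} → p < q → p - q < 0ℚ
  p<q⇒p-q<0 {p} {q} p<q = subst (p - q <_) (+-inverseʳ q) (+-monoˡ-< (- q) p<q)

  p<0⇒0<-p : ∀ {p} → p < 0ℚ → 0ℚ < - p
  p<0⇒0<-p {p} p<0 = subst (_< - p) (+-inverseʳ p) (subst (p + - p <_) (+-identityˡ (- p)) (+-monoˡ-< (- p) p<0))

  p≤q⇒0≤q-p : ∀ {p q} → p ≤ q → 0ℚ ≤ q - p
  p≤q⇒0≤q-p {p} {q} p≤q = subst (_≤ q - p) (+-inverseʳ p) (+-monoˡ-≤ (- p) p≤q)

  0≤q-p⇒p≤q : ∀ {p q} → 0ℚ ≤ q - p → p ≤ q
  0≤q-p⇒p≤q {p} {q} 0≤q-p =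
    subst₂ _≤_ (+-identityˡ p) (solve 2 (λ q p → (q :- p) :+ p := q) refl q p) (+-monoˡ-≤ p 0≤q-p)

  q-p≡0⇒p≡q : ∀ {p q} → q - p ≡ 0ℚ → p ≡ q
  q-p≡0⇒p≡q {p} {q} eq =
    trans (sym (+-identityˡ p)) (trans (cong (_+ p) (sym eq)) (solve 2 (λ q p → (q :- p) :+ p := q) refl q p))

  p≡q⇒q-p≡0 : ∀ {p q} → p ≡ q → q - p ≡ 0ℚ
  p≡q⇒q-p≡0 {p} refl = +-inverseʳ p

  pos*pos : ∀ {p q} → 0ℚ < p → 0ℚ < q → 0ℚ < p * q
  pos*pos {p} {q} 0<p 0<q = positive⁻¹ (p * q) {{pos*pos⇒pos p {{positive 0<p}} q {{positive 0<q}}}}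

  nonNeg*nonNeg : ∀ {p q} → 0ℚ ≤ p → 0ℚ ≤ q → 0ℚ ≤ p * q
  nonNeg*nonNeg {p} {q} 0≤p 0≤q = nonNegative⁻¹ (p * q) {{nonNeg*nonNeg⇒nonNeg p {{nonNegative 0≤p}} q {{nonNegative 0≤q}}}}

  0≤p∧p≢0⇒0<p : ∀ {p} → 0ℚ ≤ p → p ≢ 0ℚ → 0ℚ < p
  0≤p∧p≢0⇒0<p {p} 0≤p p≢0 with <-cmp 0ℚ p
  ... | tri< 0<p _ _ = 0<p
  ... | tri≈ _ 0≡p _ = ⊥-elim (p≢0 (sym 0≡p))
  ... | tri> _ _ p<0 = ⊥-elim (<-irrefl refl (<-≤-trans p<0 0≤p))

  nonNeg+nonNeg≡0 : ∀ {p q} → 0ℚ ≤ p → 0ℚ ≤ q → p + q ≡ 0ℚ → p ≡ 0ℚ × q ≡ 0ℚ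
  nonNeg+nonNeg≡0 {p} {q} 0≤p 0≤q p+q≡0 = p≡0 , trans (sym (+-identityˡ q)) (trans (cong (_+ q) (sym p≡0)) p+q≡0)
    where
    p≡0 : p ≡ 0ℚ
    p≡0 = ≤-antisym (subst (p ≤_) p+q≡0 (subst (_≤ p + q) (+-identityʳ p) (+-monoʳ-≤ p 0≤q))) 0≤p

  signed : Bool → ℚ → ℚ
  signed true  p = p
  signed false p = - p

  signed-- : ∀ s p q → signed s (p - q) ≡ signed s p + signed (not s) q
  signed-- true  p q = refl
  signed-- false = solve 2 (λ p q → :- (p :- q) := (:- p) :+ q) refl

  signed≡0 : ∀ s p → signed s p ≡ 0ℚ → p ≡ 0ℚ
  signed≡0 true  p eq = eq
  signed≡0 false p eq = neg-injective eq

  signed-0 : ∀ s → signed s 0ℚ ≡ 0ℚ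
  signed-0 true  = refl
  signed-0 false = refl

  signed-*ˡ : ∀ s p q → signed s (p * q) ≡ p * signed s q
  signed-*ˡ true  p q = refl
  signed-*ˡ false p q = neg-distribʳ-* p q

  signed-not-*ˡ : ∀ s p q → signed (not s) (p * q) ≡ (- p) * signed s q
  signed-not-*ˡ true  p q = neg-distribˡ-* p q
  signed-not-*ˡ false = solve 2 (λ p q → p :* q := (:- p) :* (:- q)) refl

  signed-*ʳ : ∀ s p q → signed s (p * q) ≡ signed s p * q
  signed-*ʳ true  p q = refl
  signed-*ʳ false p q = neg-distribˡ-* p q

  signed-vanishing : ∀ s {q} → q ≡ 0ℚ → 0ℚ ≤ signed s q
  signed-vanishing s q≡0 = ≤-reflexive (sym (trans (cong (signed s) q≡0) (signed-0 s)))

  signed-1 : ∀ s p → p * (signed s 1ℚ + 0ℚ) ≡ signed s p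
  signed-1 true  p = trans (cong (p *_) (+-identityʳ 1ℚ)) (*-identityʳ p)
  signed-1 false = solve 1 (λ p → p :* ((:- con 1ℚ) :+ con 0ℚ) := :- p) refl

  -- Coefficient lists, constant term first.
  Poly : Set
  Poly = List ℚ

  evalP : Poly → ℚ → ℚ
  evalP []      t = 0ℚ
  evalP (c ∷ p) t = c + t * evalP p t

  addConst : ℚ → Poly → Poly
  addConst c []      = c ∷ []
  addConst c (d ∷ p) = (c + d) ∷ p

  mulLinear : ℚ → Poly → Poly
  mulLinear r []      = []
  mulLinear r (c ∷ p) = (- (r * c)) ∷ addConst c (mulLinear r p)

  _+P_ : Poly → Poly → Poly
  []      +P q       = q
  (a ∷ p) +P []      = a ∷ p
  (a ∷ p) +P (b ∷ q) = (a + b) ∷ (p +P q)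

  mulX : Poly → Poly
  mulX []      = []
  mulX (c ∷ p) = 0ℚ ∷ c ∷ p

  shift : Poly → Poly
  shift []      = []
  shift (c ∷ p) = addConst c (mulLinear (- 1ℚ) (shift p))

  -- the forward difference: if p = c + t q then Δp = t Δq + q(t + 1)
  Δ : Poly → Poly
  Δ []      = []
  Δ (c ∷ p) = mulX (Δ p) +P shift p

  Δ^ : ℕ → Poly → Poly
  Δ^ zero    p = p
  Δ^ (suc j) p = Δ (Δ^ j p)

  evalP-addConst : ∀ c p t → evalP (addConst c p) t ≡ c + evalP p t
  evalP-addConst c []      t = cong (c +_) (*-zeroʳ t)
  evalP-addConst c (d ∷ p) t = +-assoc c d (t * evalP p t)

  evalP-mulLinear : ∀ r p t → evalP (mulLinear r p) t ≡ (t - r) * evalP p t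
  evalP-mulLinear r []      t = sym (*-zeroʳ (t - r))
  evalP-mulLinear r (c ∷ p) t rewrite evalP-addConst c (mulLinear r p) t | evalP-mulLinear r p t =
    solve 4 (λ r c t e → (:- (r :* c)) :+ t :* (c :+ (t :- r) :* e) := (t :- r) :* (c :+ t :* e)) refl r c t (evalP p t)

  evalP-+P : ∀ p q t → evalP (p +P q) t ≡ evalP p t + evalP q t
  evalP-+P []      q       t = sym (+-identityˡ (evalP q t))
  evalP-+P (a ∷ p) []      t = sym (+-identityʳ _)
  evalP-+P (a ∷ p) (b ∷ q) t rewrite evalP-+P p q t =
    solve 5 (λ a b t x y → (a :+ b) :+ t :* (x :+ y) := (a :+ t :* x) :+ (b :+ t :* y)) refl a b t (evalP p t) (evalP q t)

  evalP-mulX : ∀ p t → evalP (mulX p) t ≡ t * evalP p t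
  evalP-mulX []      t = sym (*-zeroʳ t)
  evalP-mulX (c ∷ p) t = +-identityˡ _

  evalP-shift : ∀ p t → evalP (shift p) t ≡ evalP p (t + 1ℚ)
  evalP-shift []      t = refl
  evalP-shift (c ∷ p) t
    rewrite evalP-addConst c (mulLinear (- 1ℚ) (shift p)) t | evalP-mulLinear (- 1ℚ) (shift p) t | evalP-shift p t =
    cong (c +_) (cong (_* evalP p (t + 1ℚ)) (solve 1 (λ t → t :- (:- con 1ℚ) := t :+ con 1ℚ) refl t))

  evalP-Δ : ∀ p t → evalP (Δ p) t ≡ evalP p (t + 1ℚ) - evalP p t
  evalP-Δ []      t = refl
  evalP-Δ (c ∷ p) t rewrite evalP-+P (mulX (Δ p)) (shift p) t | evalP-mulX (Δ p) t | evalP-Δ p t | evalP-shift p t =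
    solve 4 (λ c t A B → t :* (A :- B) :+ A := (c :+ (t :+ con 1ℚ) :* A) :- (c :+ t :* B)) refl c t (evalP p (t + 1ℚ)) (evalP p t)

  length-addConst : ∀ c p n → length p ℕ.≤ suc n → length (addConst c p) ℕ.≤ suc n
  length-addConst c []      n _   = s≤s z≤n
  length-addConst c (d ∷ p) n len = len

  length-mulLinear : ∀ r p → length (mulLinear r p) ℕ.≤ suc (length p)
  length-mulLinear r []      = z≤n
  length-mulLinear r (c ∷ p) = s≤s (length-addConst c (mulLinear r p) (length p) (length-mulLinear r p))

  length-shift : ∀ p → length (shift p) ℕ.≤ length p
  length-shift []      = z≤n
  length-shift (c ∷ p) =
    length-addConst c (mulLinear (- 1ℚ) (shift p)) (length p)
      (ℕ.≤-trans (length-mulLinear (- 1ℚ) (shift p)) (s≤s (length-shift p)))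

  length-+P : ∀ p q n → length p ℕ.≤ n → length q ℕ.≤ n → length (p +P q) ℕ.≤ n
  length-+P []      q       n       _         len-q     = len-q
  length-+P (a ∷ p) []      n       len-p     _         = len-p
  length-+P (a ∷ p) (b ∷ q) (suc n) (s≤s len-p) (s≤s len-q) = s≤s (length-+P p q n len-p len-q)

  length-mulX : ∀ q n → length q ℕ.≤ n ℕ.∸ 1 → length (mulX q) ℕ.≤ n
  length-mulX []      n       _   = z≤n
  length-mulX (c ∷ q) (suc n) len = s≤s len

  length-Δ : ∀ p → length (Δ p) ℕ.≤ length p ℕ.∸ 1
  length-Δ []      = z≤n
  length-Δ (c ∷ p) = length-+P (mulX (Δ p)) (shift p) (length p) (length-mulX (Δ p) (length p) (length-Δ p)) (length-shift p)

  length-Δ^ : ∀ j p → length (Δ^ j p) ℕ.≤ length p ℕ.∸ j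
  length-Δ^ zero    p = ℕ.≤-refl
  length-Δ^ (suc j) p = ℕ.≤-trans (length-Δ (Δ^ j p))
    (ℕ.≤-trans (ℕ.∸-monoˡ-≤ 1 (length-Δ^ j p))
               (ℕ.≤-reflexive (trans (ℕ.∸-+-assoc (length p) j 1) (cong (length p ℕ.∸_) (ℕ.+-comm j 1)))))

  Δ^-vanishes : ∀ j p t → length p ℕ.≤ j → evalP (Δ^ j p) t ≡ 0ℚ
  Δ^-vanishes j p t len with Δ^ j p | length-Δ^ j p
  ... | []    | _   = refl
  ... | c ∷ q | len′ =
    ⊥-elim (ℕ.<-irrefl refl (ℕ.<-≤-trans (s≤s z≤n) (ℕ.≤-trans len′ (ℕ.≤-reflexive (ℕ.m≤n⇒m∸n≡0 len)))))

  AlternatesFrom : Bool → Poly → ℕ → ℕ → Set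
  AlternatesFrom s p a j = ∀ u → u ℕ.≤ j → 0ℚ ≤ signed (s xor isEven (a ℕ.+ u)) (evalP p (ι (a ℕ.+ u)))

  -- Δ^j p (a) = Σ (−1)^(j−u) (j choose u) p(a + u): when the p(a + u) weakly alternate,
  -- all the summands have the same sign, so the sum vanishes only if they all do.
  alternating-Δ^ : ∀ j p a s → AlternatesFrom s p a j →
    0ℚ ≤ signed (s xor isEven (a ℕ.+ j)) (evalP (Δ^ j p) (ι a)) ×
    (evalP (Δ^ j p) (ι a) ≡ 0ℚ → ∀ u → u ℕ.≤ j → evalP p (ι (a ℕ.+ u)) ≡ 0ℚ)
  alternating-Δ^ zero p a s alt =
    subst (λ k → 0ℚ ≤ signed (s xor isEven (a ℕ.+ 0)) (evalP p (ι k))) (ℕ.+-identityʳ a) (alt 0 z≤n) ,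
    λ { eq .zero z≤n → trans (cong (λ k → evalP p (ι k)) (ℕ.+-identityʳ a)) eq }
  alternating-Δ^ (suc j) p a s alt = nonneg , vanishing
    where
    A B : ℚ
    A = evalP (Δ^ j p) (ι (suc a))
    B = evalP (Δ^ j p) (ι a)
    difference : evalP (Δ^ (suc j) p) (ι a) ≡ A - B
    difference = trans (evalP-Δ (Δ^ j p) (ι a)) (cong (λ t → evalP (Δ^ j p) t - B) (sym (ι-suc a)))
    alt-right : AlternatesFrom s p (suc a) j
    alt-right u u≤j =
      subst (λ k → 0ℚ ≤ signed (s xor isEven k) (evalP p (ι k))) (ℕ.+-suc a u) (alt (suc u) (s≤s u≤j))
    alt-left : AlternatesFrom s p a j
    alt-left u u≤j = alt u (ℕ.m≤n⇒m≤1+n u≤j)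
    c : Bool
    c = s xor not (isEven (a ℕ.+ j))
    c-left : s xor isEven (a ℕ.+ j) ≡ not c
    c-left = trans (sym (not-involutive _)) (cong not (not-distribʳ-xor s (isEven (a ℕ.+ j))))
    A-nonneg : 0ℚ ≤ signed c A
    A-nonneg = proj₁ (alternating-Δ^ j p (suc a) s alt-right)
    B-nonneg : 0ℚ ≤ signed (not c) B
    B-nonneg = subst (λ b → 0ℚ ≤ signed b B) c-left (proj₁ (alternating-Δ^ j p a s alt-left))
    A-vanishing : A ≡ 0ℚ → ∀ u → u ℕ.≤ j → evalP p (ι (suc a ℕ.+ u)) ≡ 0ℚ
    A-vanishing = proj₂ (alternating-Δ^ j p (suc a) s alt-right)
    B-vanishing : B ≡ 0ℚ → ∀ u → u ℕ.≤ j → evalP p (ι (a ℕ.+ u)) ≡ 0ℚ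
    B-vanishing = proj₂ (alternating-Δ^ j p a s alt-left)
    split : signed c (A - B) ≡ signed c A + signed (not c) B
    split = signed-- c A B
    nonneg : 0ℚ ≤ signed (s xor isEven (a ℕ.+ suc j)) (evalP (Δ^ (suc j) p) (ι a))
    nonneg rewrite ℕ.+-suc a j | difference | split =
      subst (_≤ signed c A + signed (not c) B) (+-identityʳ 0ℚ) (+-mono-≤ A-nonneg B-nonneg)
    vanishing : evalP (Δ^ (suc j) p) (ι a) ≡ 0ℚ → ∀ u → u ℕ.≤ suc j → evalP p (ι (a ℕ.+ u)) ≡ 0ℚ
    vanishing eq = vanish-at
      where
      both : signed c A ≡ 0ℚ × signed (not c) B ≡ 0ℚ
      both = nonNeg+nonNeg≡0 A-nonneg B-nonneg
               (trans (sym split) (trans (cong (signed c) (trans (sym difference) eq)) (signed-0 c)))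
      vanish-at : ∀ u → u ℕ.≤ suc j → evalP p (ι (a ℕ.+ u)) ≡ 0ℚ
      vanish-at zero    _         = B-vanishing (signed≡0 (not c) B (proj₂ both)) zero z≤n
      vanish-at (suc u) (s≤s u≤j) =
        trans (cong (λ k → evalP p (ι k)) (ℕ.+-suc a u)) (A-vanishing (signed≡0 c A (proj₁ both)) u u≤j)

  alternating⇒vanishing : ∀ N p s → length p ℕ.≤ N → AlternatesFrom s p 1 N →
    ∀ u → u ℕ.≤ N → evalP p (ι (suc u)) ≡ 0ℚ
  alternating⇒vanishing N p s len alt = proj₂ (alternating-Δ^ N p 1 s alt) (Δ^-vanishes N p (ι 1) len)

  -- the root of index r is the point r + 1
  rootProduct : List ℕ → ℚ → ℚ
  rootProduct []       t = 1ℚ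
  rootProduct (r ∷ rs) t = (t - ι (suc r)) * rootProduct rs t

  mulRoots : List ℕ → Poly → Poly
  mulRoots []       p = p
  mulRoots (r ∷ rs) p = mulLinear (ι (suc r)) (mulRoots rs p)

  evalP-mulRoots : ∀ rs p t → evalP (mulRoots rs p) t ≡ rootProduct rs t * evalP p t
  evalP-mulRoots []       p t = sym (*-identityˡ _)
  evalP-mulRoots (r ∷ rs) p t rewrite evalP-mulLinear (ι (suc r)) (mulRoots rs p) t | evalP-mulRoots rs p t =
    sym (*-assoc (t - ι (suc r)) (rootProduct rs t) (evalP p t))

  length-mulRoots : ∀ rs p → length (mulRoots rs p) ℕ.≤ length p ℕ.+ length rs
  length-mulRoots []       p = ℕ.m≤m+n _ 0
  length-mulRoots (r ∷ rs) p = ℕ.≤-trans (length-mulLinear _ (mulRoots rs p))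
    (ℕ.≤-trans (s≤s (length-mulRoots rs p)) (ℕ.≤-reflexive (sym (ℕ.+-suc (length p) (length rs)))))

  countAbove : ℕ → List ℕ → ℕ
  countAbove v []       = 0
  countAbove v (r ∷ rs) = (if v ℕ.<ᵇ r then 1 else 0) ℕ.+ countAbove v rs

  rootProduct-root : ∀ v rs → v ∈ rs → rootProduct rs (ι (suc v)) ≡ 0ℚ
  rootProduct-root v (r ∷ rs) (here refl) =
    trans (cong (_* rootProduct rs (ι (suc v))) (+-inverseʳ (ι (suc v)))) (*-zeroˡ (rootProduct rs (ι (suc v))))
  rootProduct-root v (r ∷ rs) (there v∈rs) =
    trans (cong ((ι (suc v) - ι (suc r)) *_) (rootProduct-root v rs v∈rs)) (*-zeroʳ (ι (suc v) - ι (suc r)))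

  rootProduct-sign : ∀ v rs → ¬ (v ∈ rs) → 0ℚ < signed (isEven (countAbove v rs)) (rootProduct rs (ι (suc v)))
  rootProduct-sign v []       _    = 0<1
  rootProduct-sign v (r ∷ rs) v∉rs with v ℕ.<ᵇ r in v<ᵇr
  ... | true  = subst (0ℚ <_) (sym (signed-not-*ˡ (isEven (countAbove v rs)) (ι (suc v) - ι (suc r)) (rootProduct rs (ι (suc v)))))
                  (pos*pos (p<0⇒0<-p (p<q⇒p-q<0 (ι-mono-< (s≤s (ℕ.<ᵇ⇒< v r (subst T (sym v<ᵇr) _))))))
                           (rootProduct-sign v rs (λ v∈rs → v∉rs (there v∈rs))))
  ... | false = subst (0ℚ <_) (sym (signed-*ˡ (isEven (countAbove v rs)) (ι (suc v) - ι (suc r)) (rootProduct rs (ι (suc v)))))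
                  (pos*pos (p<q⇒0<q-p (ι-mono-< (s≤s r<v))) (rootProduct-sign v rs (λ v∈rs → v∉rs (there v∈rs))))
    where
    r<v : r ℕ.< v
    r<v = ℕ.≤∧≢⇒< (ℕ.≮⇒≥ (λ v<r → subst T v<ᵇr (ℕ.<⇒<ᵇ v<r))) (λ { refl → v∉rs (here refl) })

module AlternatingWords where

  open import Defs using (Gen; 𝐚; 𝐛)
  open Dihedral using (other; other-involutive; alternating; isEven)
  open GreedySubwords using (_==_; repeats; repeats-true; greedy)
  open Polynomials using (countAbove)
  open import Data.Nat using (ℕ; zero; suc; _+_; _<_; z≤n; s≤s)
  open import Data.Nat.Properties using (+-comm; +-suc; +-identityʳ)
  open import Data.Bool using (Bool; true; false; not; if_then_else_; _xor_)
  open import Data.Bool.Properties using (not-involutive; not-distribˡ-xor; not-distribʳ-xor)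
  open import Data.Maybe using (Maybe; just; nothing; is-just)
  open import Data.Product using (Σ; _×_; _,_)
  open import Data.List using (List; []; _∷_; length; map)
  open import Data.List.Properties using (length-map)
  open import Data.List.Membership.Propositional using (_∈_)
  open import Data.List.Relation.Unary.Any using (here; there)
  open import Data.Vec using ([]; _∷_)
  import Data.Vec as Vec
  open import Data.Fin using (Fin; toℕ)
  import Data.Fin as Fin
  open import Data.Fin.Subset using (Subset; ⊤) renaming (_∈_ to _∈ₛ_)
  open import Data.Empty using (⊥-elim)
  open import Relation.Nullary using (¬_)
  open import Relation.Binary.PropositionalEquality

  -- Positions are natural numbers here; indices beyond the end count as members.
  member : ∀ {n} → Subset n → ℕ → Bool
  member []      u       = true
  member (b ∷ P) zero    = b
  member (b ∷ P) (suc u) = member P u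

  ∈⇒member : ∀ {n} (P : Subset n) i → i ∈ₛ P → member P (toℕ i) ≡ true
  ∈⇒member (b ∷ P) Fin.zero    Vec.here        = refl
  ∈⇒member (b ∷ P) (Fin.suc i) (Vec.there i∈P) = ∈⇒member P i i∈P

  member⇒∈ : ∀ {n} (P : Subset n) i → member P (toℕ i) ≡ true → i ∈ₛ P
  member⇒∈ (true ∷ P) Fin.zero    refl = Vec.here
  member⇒∈ (b    ∷ P) (Fin.suc i) eq   = Vec.there (member⇒∈ P i eq)

  free⇒< : ∀ {n} (P : Subset n) u → member P u ≡ false → u < n
  free⇒< (b ∷ P) zero    _    = s≤s z≤n
  free⇒< (b ∷ P) (suc u) free = s≤s (free⇒< P u free)

  ≢⊤⇒free : ∀ {n} (P : Subset n) → P ≢ ⊤ → Σ ℕ λ u → member P u ≡ false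
  ≢⊤⇒free []          P≢⊤ = ⊥-elim (P≢⊤ refl)
  ≢⊤⇒free (false ∷ P) _   = 0 , refl
  ≢⊤⇒free (true  ∷ P) P≢⊤ with ≢⊤⇒free P (λ eq → P≢⊤ (cong (true ∷_) eq))
  ... | u , free = suc u , free

  -- In what follows P is a subset of the positions of the alternating word starting with x;
  -- positions outside P are called free.

  firstFree : ∀ {n} → Gen → Subset n → Maybe Gen
  firstFree x []          = nothing
  firstFree x (true  ∷ P) = firstFree (other x) P
  firstFree x (false ∷ P) = just x

  -- the free letter after a free head x is again x (an odd number of positions of P lie in between)
  nextFreeSame : ∀ {n} → Gen → Subset n → Bool
  nextFreeSame x P = repeats (firstFree (other x) P) x

  -- the number of maximal blocks of equal letters in the sequence of free letters
  runs : ∀ {n} → Gen → Subset n → ℕ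
  runs x []          = 0
  runs x (true  ∷ P) = runs (other x) P
  runs x (false ∷ P) = (if nextFreeSame x P then 0 else 1) + runs (other x) P

  firstFree-exists : ∀ {n} x (P : Subset n) u → member P u ≡ false → Σ Gen λ y → firstFree x P ≡ just y
  firstFree-exists x (true  ∷ P) zero    ()
  firstFree-exists x (false ∷ P) zero    _    = x , refl
  firstFree-exists x (true  ∷ P) (suc u) free = firstFree-exists (other x) P u free
  firstFree-exists x (false ∷ P) (suc u) _    = x , refl

  runs-⊤ : ∀ {n} x (P : Subset n) → P ≡ ⊤ → runs x P ≡ 0
  runs-⊤ x []          _    = refl
  runs-⊤ x (true ∷ P) P≡⊤ = runs-⊤ (other x) P (cong Vec.tail P≡⊤)

  ==-other : ∀ y x → (y == other x) ≡ not (y == x)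
  ==-other 𝐚 𝐚 = refl
  ==-other 𝐚 𝐛 = refl
  ==-other 𝐛 𝐚 = refl
  ==-other 𝐛 𝐛 = refl

  ==-sym : ∀ x y → (x == y) ≡ (y == x)
  ==-sym 𝐚 𝐚 = refl
  ==-sym 𝐚 𝐛 = refl
  ==-sym 𝐛 𝐚 = refl
  ==-sym 𝐛 𝐛 = refl

  self==other : ∀ x → (x == other x) ≡ false
  self==other 𝐚 = refl
  self==other 𝐛 = refl

  other==self : ∀ x → (other x == x) ≡ false
  other==self 𝐚 = refl
  other==self 𝐛 = refl

  countAbove-map-suc : ∀ v xs → countAbove (suc v) (map suc xs) ≡ countAbove v xs
  countAbove-map-suc v []       = refl
  countAbove-map-suc v (x ∷ xs) = cong (_ +_) (countAbove-map-suc v xs)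

  countAbove-0≡length : ∀ xs → countAbove 0 (map suc xs) ≡ length (map suc xs)
  countAbove-0≡length []       = refl
  countAbove-0≡length (x ∷ xs) = cong suc (countAbove-0≡length xs)

  ∈-map-suc⁻ : ∀ {v} xs → suc v ∈ map suc xs → v ∈ xs
  ∈-map-suc⁻ (x ∷ xs) (here refl)  = here refl
  ∈-map-suc⁻ (x ∷ xs) (there v∈xs) = there (∈-map-suc⁻ xs v∈xs)

  ∈-map-suc⁺ : ∀ {v} xs → v ∈ xs → suc v ∈ map suc xs
  ∈-map-suc⁺ (x ∷ xs) (here refl)  = here refl
  ∈-map-suc⁺ (x ∷ xs) (there v∈xs) = there (∈-map-suc⁺ xs v∈xs)

  0∉map-suc : ∀ xs → ¬ (0 ∈ map suc xs)
  0∉map-suc (x ∷ xs) (there 0∈xs) = 0∉map-suc xs 0∈xs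

  -- The roots used to separate a face: all of P, with a second root just after every free
  -- letter whose successor free letter is the same (so that the number of roots between
  -- two consecutive free positions is always even).
  faceRoots : ∀ {n} → Gen → Subset n → List ℕ
  faceRoots x []          = []
  faceRoots x (true  ∷ P) = 0 ∷ map suc (faceRoots (other x) P)
  faceRoots x (false ∷ P) =
    if nextFreeSame x P then 1 ∷ map suc (faceRoots (other x) P) else map suc (faceRoots (other x) P)

  -- parity of the number of face roots beyond the first free position
  faceRootsSign : ∀ {n} → Gen → Subset n → Bool
  faceRootsSign x []          = true
  faceRootsSign x (true  ∷ P) = faceRootsSign (other x) P
  faceRootsSign x (false ∷ P) = isEven (length (faceRoots x (false ∷ P)))

  faceRoots⊆P : ∀ {n} x (P : Subset n) r → r ∈ faceRoots x P → member P r ≡ true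
  faceRoots⊆P x (true  ∷ P) zero    _            = refl
  faceRoots⊆P x (true  ∷ P) (suc r) (there r∈R)  = faceRoots⊆P (other x) P r (∈-map-suc⁻ _ r∈R)
  faceRoots⊆P x (false ∷ P) r       r∈R with nextFreeSame x P in same
  faceRoots⊆P x (false ∷ P) zero    (there r∈R) | true = ⊥-elim (0∉map-suc _ r∈R)
  faceRoots⊆P x (false ∷ P) (suc r) (there r∈R) | true = faceRoots⊆P (other x) P r (∈-map-suc⁻ _ r∈R)
  faceRoots⊆P x (false ∷ P) zero    r∈R         | false = ⊥-elim (0∉map-suc _ r∈R)
  faceRoots⊆P x (false ∷ P) (suc r) r∈R         | false = faceRoots⊆P (other x) P r (∈-map-suc⁻ _ r∈R)
  faceRoots⊆P x (false ∷ true  ∷ P) (suc zero) (here refl) | true = refl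
  faceRoots⊆P x (false ∷ false ∷ P) (suc zero) (here refl) | true with trans (sym same) (other==self x)
  ... | ()

  P⊆faceRoots : ∀ {n} x (P : Subset n) u → member P u ≡ true → u < n → u ∈ faceRoots x P
  P⊆faceRoots x (true  ∷ P) zero    _   _         = here refl
  P⊆faceRoots x (false ∷ P) zero    ()  _
  P⊆faceRoots x (true  ∷ P) (suc u) u∈P (s≤s u<n) = there (∈-map-suc⁺ _ (P⊆faceRoots (other x) P u u∈P u<n))
  P⊆faceRoots x (false ∷ P) (suc u) u∈P (s≤s u<n) with nextFreeSame x P
  ... | true  = there (∈-map-suc⁺ _ (P⊆faceRoots (other x) P u u∈P u<n))
  ... | false = ∈-map-suc⁺ _ (P⊆faceRoots (other x) P u u∈P u<n)

  length-faceRoots : ∀ {n} x (P : Subset n) → length (faceRoots x P) + runs x P ≡ n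
  length-faceRoots x [] = refl
  length-faceRoots x (true ∷ P) =
    cong suc (trans (cong (_+ runs (other x) P) (length-map suc (faceRoots (other x) P))) (length-faceRoots (other x) P))
  length-faceRoots x (false ∷ P) with nextFreeSame x P
  ... | true  =
    cong suc (trans (cong (_+ runs (other x) P) (length-map suc (faceRoots (other x) P))) (length-faceRoots (other x) P))
  ... | false = begin
    length (map suc R) + suc (runs (other x) P) ≡⟨ cong (_+ suc (runs (other x) P)) (length-map suc R) ⟩
    length R + suc (runs (other x) P)           ≡⟨ +-suc (length R) (runs (other x) P) ⟩
    suc (length R + runs (other x) P)           ≡⟨ cong suc (length-faceRoots (other x) P) ⟩
    suc _                                        ∎
    where
    open ≡-Reasoning
    R : List ℕ
    R = faceRoots (other x) P

  faceRoots-parity : ∀ {n} x (P : Subset n) y → firstFree x P ≡ just y →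
    isEven (length (faceRoots x P)) ≡ (y == other x) xor faceRootsSign x P
  faceRoots-parity x (true ∷ P) y first = begin
    not (isEven (length (map suc R)))          ≡⟨ cong (λ k → not (isEven k)) (length-map suc R) ⟩
    not (isEven (length R))                    ≡⟨ cong not (faceRoots-parity (other x) P y first) ⟩
    not ((y == other (other x)) xor σ)         ≡⟨ cong (λ z → not ((y == z) xor σ)) (other-involutive x) ⟩
    not ((y == x) xor σ)                       ≡⟨ not-distribˡ-xor (y == x) σ ⟩
    not (y == x) xor σ                         ≡⟨ cong (_xor σ) (sym (==-other y x)) ⟩
    (y == other x) xor σ                       ∎
    where
    open ≡-Reasoning
    R : List ℕ
    R = faceRoots (other x) P
    σ : Bool
    σ = faceRootsSign (other x) P
  faceRoots-parity x (false ∷ P) .x refl rewrite self==other x = refl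

  faceRoots-sign : ∀ {n} x (P : Subset n) v → member P v ≡ false →
    isEven (countAbove v (faceRoots x P)) ≡ faceRootsSign x P
  faceRoots-sign x (false ∷ P) zero _ with nextFreeSame x P
  ... | true  = cong (λ k → isEven (suc k)) (countAbove-0≡length (faceRoots (other x) P))
  ... | false = cong isEven (countAbove-0≡length (faceRoots (other x) P))
  faceRoots-sign x (true ∷ P) (suc v) free =
    trans (cong isEven (countAbove-map-suc v (faceRoots (other x) P))) (faceRoots-sign (other x) P v free)
  faceRoots-sign x (false ∷ P) (suc v) free
    with firstFree-exists (other x) P v free | nextFreeSame x P in same
  ... | y , first | b = begin
    isEven (countAbove (suc v) (if b then 1 ∷ map suc R else map suc R)) ≡⟨ cong isEven (skip-extra b) ⟩
    isEven (countAbove (suc v) (map suc R))         ≡⟨ cong isEven (countAbove-map-suc v R) ⟩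
    isEven (countAbove v R)                         ≡⟨ faceRoots-sign (other x) P v free ⟩
    σ                                               ≡⟨ parity b y==x ⟩
    isEven (length (if b then 1 ∷ map suc R else map suc R)) ∎
    where
    open ≡-Reasoning
    R : List ℕ
    R = faceRoots (other x) P
    σ : Bool
    σ = faceRootsSign (other x) P
    skip-extra : ∀ b → countAbove (suc v) (if b then 1 ∷ map suc R else map suc R) ≡ countAbove (suc v) (map suc R)
    skip-extra true  = refl
    skip-extra false = refl
    y==x : (y == x) ≡ b
    y==x = trans (sym (cong (λ ℓ → repeats ℓ x) first)) same
    length-R : isEven (length R) ≡ (y == x) xor σ
    length-R = trans (faceRoots-parity (other x) P y first) (cong (λ z → (y == z) xor σ) (other-involutive x))
    parity : ∀ b → (y == x) ≡ b → σ ≡ isEven (length (if b then 1 ∷ map suc R else map suc R))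
    parity true  eq rewrite length-map suc R | length-R | eq = sym (not-involutive σ)
    parity false eq rewrite length-map suc R | length-R | eq = refl

  -- the free letter after a free head x is the other letter (an even number of positions of P lie in between)
  nextFreeOther : ∀ {n} → Gen → Subset n → Bool
  nextFreeOther x P = repeats (firstFree (other x) P) (other x)

  -- The auxiliary roots for the converse direction: every free position at which the
  -- free letter changes.
  flipRoots : ∀ {n} → Gen → Subset n → List ℕ
  flipRoots x []          = []
  flipRoots x (true  ∷ P) = map suc (flipRoots (other x) P)
  flipRoots x (false ∷ P) =
    if nextFreeOther x P then 0 ∷ map suc (flipRoots (other x) P) else map suc (flipRoots (other x) P)

  -- the common parity of u + #(flip roots beyond u) over the free positions u that are not flip roots
  flipRootsSign : ∀ {n} → Gen → Subset n → Bool
  flipRootsSign x []          = true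
  flipRootsSign x (true  ∷ P) = not (flipRootsSign (other x) P)
  flipRootsSign x (false ∷ P) =
    if is-just (firstFree (other x) P) then not (flipRootsSign (other x) P) else isEven (length (flipRoots (other x) P))

  length-flipRoots : ∀ {n} x (P : Subset n) →
    length (flipRoots x P) + (if is-just (firstFree x P) then 1 else 0) ≡ runs x P
  length-flipRoots x [] = refl
  length-flipRoots x (true ∷ P) =
    trans (cong (_+ (if is-just (firstFree (other x) P) then 1 else 0)) (length-map suc (flipRoots (other x) P)))
          (length-flipRoots (other x) P)
  length-flipRoots x (false ∷ P) with firstFree (other x) P | length-flipRoots (other x) P
  ... | nothing | ih = trans (cong (_+ 1) (length-map suc (flipRoots (other x) P)))
                            (trans (+-comm _ 1) (cong suc (trans (sym (+-identityʳ _)) ih)))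
  ... | just z | ih with z == x in z==x
  ...   | true  rewrite trans (==-other z x) (cong not z==x) =
    trans (cong (_+ 1) (length-map suc (flipRoots (other x) P))) ih
  ...   | false rewrite trans (==-other z x) (cong not z==x) =
    cong suc (trans (cong (_+ 1) (length-map suc (flipRoots (other x) P))) ih)

  flipRoots-parity : ∀ {n} x (P : Subset n) y → firstFree x P ≡ just y →
    isEven (length (flipRoots x P)) ≡ (y == other x) xor flipRootsSign x P
  flipRoots-parity x (true ∷ P) y first = begin
    isEven (length (map suc Y))                ≡⟨ cong isEven (length-map suc Y) ⟩
    isEven (length Y)                          ≡⟨ flipRoots-parity (other x) P y first ⟩
    (y == other (other x)) xor σ               ≡⟨ cong (λ z → (y == z) xor σ) (other-involutive x) ⟩
    (y == x) xor σ                             ≡⟨ sym (not-involutive _) ⟩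
    not (not ((y == x) xor σ))                 ≡⟨ cong not (not-distribˡ-xor (y == x) σ) ⟩
    not (not (y == x) xor σ)                   ≡⟨ cong (λ b → not (b xor σ)) (sym (==-other y x)) ⟩
    not ((y == other x) xor σ)                 ≡⟨ not-distribʳ-xor (y == other x) σ ⟩
    (y == other x) xor not σ                   ∎
    where
    open ≡-Reasoning
    Y : List ℕ
    Y = flipRoots (other x) P
    σ : Bool
    σ = flipRootsSign (other x) P
  flipRoots-parity x (false ∷ P) .x refl rewrite self==other x with firstFree (other x) P in first
  ... | nothing = cong isEven (length-map suc (flipRoots (other x) P))
  ... | just z rewrite ==-other z x with flipRoots-parity (other x) P z first
  ...   | ih rewrite other-involutive x with z == x
  ...     | true  = trans (cong isEven (length-map suc (flipRoots (other x) P))) ih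
  ...     | false = cong not (trans (cong isEven (length-map suc (flipRoots (other x) P))) ih)

  countAbove-0 : ∀ xs → ¬ (0 ∈ xs) → countAbove 0 xs ≡ length xs
  countAbove-0 []           _     = refl
  countAbove-0 (zero  ∷ xs) 0∉xs = ⊥-elim (0∉xs (here refl))
  countAbove-0 (suc x ∷ xs) 0∉xs = cong suc (countAbove-0 xs (λ 0∈xs → 0∉xs (there 0∈xs)))

  flipRoots-sign : ∀ {n} x (P : Subset n) u → member P u ≡ false → ¬ (u ∈ flipRoots x P) →
    isEven (u + countAbove u (flipRoots x P)) ≡ flipRootsSign x P
  flipRoots-sign x (true ∷ P) zero () _
  flipRoots-sign x (false ∷ P) zero _ 0∉Y = begin
    isEven (countAbove 0 (flipRoots x (false ∷ P)))   ≡⟨ cong isEven (countAbove-0 _ 0∉Y) ⟩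
    isEven (length (flipRoots x (false ∷ P)))         ≡⟨ flipRoots-parity x (false ∷ P) x refl ⟩
    (x == other x) xor flipRootsSign x (false ∷ P)    ≡⟨ cong (_xor flipRootsSign x (false ∷ P)) (self==other x) ⟩
    flipRootsSign x (false ∷ P)                       ∎
    where open ≡-Reasoning
  flipRoots-sign x (true ∷ P) (suc u) free u∉Y =
    trans (cong (λ k → isEven (suc (u + k))) (countAbove-map-suc u (flipRoots (other x) P)))
          (cong not (flipRoots-sign (other x) P u free (λ u∈Y → u∉Y (∈-map-suc⁺ _ u∈Y))))
  flipRoots-sign x (false ∷ P) (suc u) free u∉Y with firstFree-exists (other x) P u free
  ... | z , first = begin
    isEven (suc u + countAbove (suc u) (extended (nextFreeOther x P)))
      ≡⟨ cong (λ k → isEven (suc (u + k))) (trans (skip-extra (nextFreeOther x P)) (countAbove-map-suc u Y)) ⟩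
    not (isEven (u + countAbove u Y))
      ≡⟨ cong not (flipRoots-sign (other x) P u free (λ u∈Y → u∉Y (lift (nextFreeOther x P) u∈Y))) ⟩
    not σ
      ≡⟨ cong (λ ℓ → if is-just ℓ then not σ else isEven (length Y)) (sym first) ⟩
    flipRootsSign x (false ∷ P) ∎
    where
    open ≡-Reasoning
    Y : List ℕ
    Y = flipRoots (other x) P
    σ : Bool
    σ = flipRootsSign (other x) P
    extended : Bool → List ℕ
    extended b = if b then 0 ∷ map suc Y else map suc Y
    skip-extra : ∀ b → countAbove (suc u) (extended b) ≡ countAbove (suc u) (map suc Y)
    skip-extra true  = refl
    skip-extra false = refl
    lift : ∀ b → u ∈ Y → suc u ∈ extended b
    lift true  u∈Y = there (∈-map-suc⁺ _ u∈Y)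
    lift false u∈Y = ∈-map-suc⁺ _ u∈Y

  -- the last free position is never a flip root
  free∉flipRoots : ∀ {n} x (P : Subset n) y → firstFree x P ≡ just y →
    Σ ℕ λ u → member P u ≡ false × ¬ (u ∈ flipRoots x P)
  free∉flipRoots x (true ∷ P) y first with free∉flipRoots (other x) P y first
  ... | u , free , u∉Y = suc u , free , λ u∈Y → u∉Y (∈-map-suc⁻ _ u∈Y)
  free∉flipRoots x (false ∷ P) y _ with firstFree (other x) P in first
  ... | nothing = 0 , refl , 0∉map-suc _
  ... | just z with free∉flipRoots (other x) P z first
  ...   | u , free , u∉Y with z == other x
  ...     | true  = suc u , free , λ { (here ()) ; (there u∈Y) → u∉Y (∈-map-suc⁻ _ u∈Y) }
  ...     | false = suc u , free , λ u∈Y → u∉Y (∈-map-suc⁻ _ u∈Y)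

  repeatsᵇ : Maybe Gen → Maybe Gen → ℕ
  repeatsᵇ ℓ nothing  = 0
  repeatsᵇ ℓ (just y) = if repeats ℓ y then 1 else 0

  repeatsᵇ-flip : ∀ (m : Maybe Gen) x → repeatsᵇ (just x) m ≡ (if repeats m x then 1 else 0)
  repeatsᵇ-flip nothing  x = refl
  repeatsᵇ-flip (just z) x = cong (λ b → if b then 1 else 0) (==-sym x z)

  absorb : ∀ {g r} b → g + (if b then 1 else 0) ≡ r → g + 1 ≡ (if b then 0 else 1) + r
  absorb true  eq = eq
  absorb false eq = trans (+-comm _ 1) (cong suc (trans (sym (+-identityʳ _)) eq))

  greedy-runs : ∀ x n ℓ (P : Subset (length (alternating x n))) →
    greedy ℓ (alternating x n) P + repeatsᵇ ℓ (firstFree x P) ≡ runs x P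
  greedy-runs x zero    ℓ []         = refl
  greedy-runs x (suc n) ℓ (true ∷ P) = greedy-runs (other x) n ℓ P
  greedy-runs x (suc n) ℓ (false ∷ P)
    with repeats ℓ x in rep
       | trans (cong (greedy (just x) (alternating (other x) n) P +_) (sym (repeatsᵇ-flip (firstFree (other x) P) x)))
               (greedy-runs (other x) n (just x) P)
  ... | true  | ih rewrite repeats-true ℓ x rep = absorb (nextFreeSame x P) ih
  ... | false | ih = trans (+-identityʳ _) (trans (+-comm 1 _) (absorb (nextFreeSame x P) ih))

  greedy≡runs : ∀ x n (P : Subset (length (alternating x n))) → greedy nothing (alternating x n) P ≡ runs x P
  greedy≡runs x n P = trans (sym (+-identityʳ _))
    (trans (cong (greedy nothing (alternating x n) P +_) (sym (repeatsᵇ-nothing (firstFree x P)))) (greedy-runs x n nothing P))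
    where
    repeatsᵇ-nothing : ∀ m → repeatsᵇ nothing m ≡ 0
    repeatsᵇ-nothing nothing  = refl
    repeatsᵇ-nothing (just y) = refl

module CyclicPolytope where

  open import Defs using (Gen; sumFin; pairing; IsPolytopeFace; CyclicBoundaryFace)
  open Dihedral using (isEven; isEven-+⇒xor)
  open Polynomials
  open AlternatingWords
  open import Data.Nat as ℕ using (ℕ; zero; suc; z≤n; s≤s)
  import Data.Nat.Properties as ℕ
  open import Data.Rational using (ℚ; 0ℚ; 1ℚ; _+_; _*_; -_; _-_; _≤_; _<_)
  open import Data.Rational.Properties
    using (*-zeroʳ; *-zeroˡ; +-identityˡ; +-inverseʳ; neg-distribʳ-*; ≤-reflexive; <⇒≤; <-irrefl)
  open import Data.Rational.Solver using (module +-*-Solver)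
  open +-*-Solver using (solve; _:+_; _:*_; :-_; _:-_; _:=_; con)
  open import Data.Product using (Σ; _×_; _,_; proj₁; proj₂)
  open import Data.List using (List; []; _∷_; length; map)
  open import Data.List.Properties using (length-map)
  open import Data.Fin using (Fin; toℕ; fromℕ<)
  open import Data.Fin.Properties using (toℕ-fromℕ<; toℕ<n)
  open import Data.Empty using (⊥; ⊥-elim)
  open import Data.Bool using (Bool; true; false; _xor_; if_then_else_)
  open import Data.Maybe using (just; is-just)
  import Data.Fin as Fin
  import Data.Vec as Vec
  open import Data.Fin.Subset using (Subset; ⊤) renaming (_∈_ to _∈ₛ_)
  open import Data.List.Membership.Propositional using (_∈_)
  open import Data.List.Membership.DecPropositional ℕ._≟_ using (_∈?_)
  open import Relation.Nullary using (¬_; yes; no)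
  open import Function using (case_of_)
  open import Relation.Binary.PropositionalEquality

  point : ∀ {n} → Fin n → ℚ
  point i = ι (suc (toℕ i))

  coefficients : ∀ d → (Fin d → ℚ) → Poly
  coefficients zero    h = []
  coefficients (suc d) h = h Fin.zero ∷ coefficients d (λ j → h (Fin.suc j))

  length-coefficients : ∀ d (h : Fin d → ℚ) → length (coefficients d h) ≡ d
  length-coefficients zero    h = refl
  length-coefficients (suc d) h = cong suc (length-coefficients d (λ j → h (Fin.suc j)))

  sumFin-cong : ∀ d (f g : Fin d → ℚ) → (∀ j → f j ≡ g j) → sumFin d f ≡ sumFin d g
  sumFin-cong zero    f g eq = refl
  sumFin-cong (suc d) f g eq =
    cong₂ _+_ (eq Fin.zero) (sumFin-cong d (λ j → f (Fin.suc j)) (λ j → g (Fin.suc j)) (λ j → eq (Fin.suc j)))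

  sum-powers : ∀ a d (h : Fin d → ℚ) e →
    sumFin d (λ j → h j * ι (a ℕ.^ (e ℕ.+ suc (toℕ j)))) ≡ ι (a ℕ.^ suc e) * evalP (coefficients d h) (ι a)
  sum-powers a zero    h e = sym (*-zeroʳ (ι (a ℕ.^ suc e)))
  sum-powers a (suc d) h e = begin
    h₀ * ι (a ℕ.^ (e ℕ.+ 1)) + sumFin d (λ j → h (Fin.suc j) * ι (a ℕ.^ (e ℕ.+ suc (suc (toℕ j)))))
      ≡⟨ cong₂ _+_ (cong (λ k → h₀ * ι (a ℕ.^ k)) (ℕ.+-comm e 1))
                   (sumFin-cong d _ _ (λ j → cong (λ k → h (Fin.suc j) * ι (a ℕ.^ k)) (ℕ.+-suc e (suc (toℕ j))))) ⟩
    h₀ * X + sumFin d (λ j → h (Fin.suc j) * ι (a ℕ.^ (suc e ℕ.+ suc (toℕ j))))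
      ≡⟨ cong (h₀ * X +_) (sum-powers a d (λ j → h (Fin.suc j)) (suc e)) ⟩
    h₀ * X + ι (a ℕ.* a ℕ.^ suc e) * R
      ≡⟨ cong (λ y → h₀ * X + y * R) (sym (ι-* a (a ℕ.^ suc e))) ⟩
    h₀ * X + (ι a * X) * R
      ≡⟨ solve 4 (λ h₀ X A R → h₀ :* X :+ (A :* X) :* R := X :* (h₀ :+ A :* R)) refl h₀ X (ι a) R ⟩
    X * (h₀ + ι a * R) ∎
    where
    open ≡-Reasoning
    h₀ X R : ℚ
    h₀ = h Fin.zero
    X  = ι (a ℕ.^ suc e)
    R  = evalP (coefficients d (λ j → h (Fin.suc j))) (ι a)

  pairing≡evalP : ∀ {n d} (h : Fin d → ℚ) (i : Fin n) →
    pairing {n} {d} h i ≡ point i * evalP (coefficients d h) (point i)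
  pairing≡evalP {n} {d} h i =
    trans (sumFin-cong d _ (λ j → h j * ι (suc (toℕ i) ℕ.^ suc (toℕ j))) (λ j → cong (h j *_) (momentCoord≡ι i j)))
      (trans (sum-powers (suc (toℕ i)) d h 0)
             (cong (λ k → ι k * evalP (coefficients d h) (point i)) (ℕ.*-identityʳ (suc (toℕ i)))))

  -- A face of C(n, d) is the zero set, among the points 1, …, n, of a polynomial of degree
  -- at most d that is nonnegative on them: for the supporting functional (h, β) take
  -- β − ⟨h, (t, …, t^d)⟩.
  record SeparatingPolynomial (d n : ℕ) (F : Subset n) : Set where
    field
      poly    : Poly
      degree  : length poly ℕ.≤ suc d
      nonneg  : ∀ (i : Fin n) → 0ℚ ≤ evalP poly (point i)
      zero⇒∈  : ∀ (i : Fin n) → evalP poly (point i) ≡ 0ℚ → i ∈ₛ F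
      ∈⇒zero  : ∀ (i : Fin n) → i ∈ₛ F → evalP poly (point i) ≡ 0ℚ

  evalP-map-neg : ∀ p t → evalP (map -_ p) t ≡ - evalP p t
  evalP-map-neg []      t = refl
  evalP-map-neg (c ∷ p) t rewrite evalP-map-neg p t =
    solve 3 (λ c t e → (:- c) :+ t :* (:- e) := :- (c :+ t :* e)) refl c t (evalP p t)

  face⇒separating : ∀ d n F → IsPolytopeFace d n F → SeparatingPolynomial d n F
  face⇒separating d n F (h , β , below , tight) = record
    { poly   = q
    ; degree = ℕ.≤-reflexive (cong suc (trans (length-map -_ (coefficients d h)) (length-coefficients d h)))
    ; nonneg = λ i → subst (0ℚ ≤_) (sym (value i)) (p≤q⇒0≤q-p (below i))
    ; zero⇒∈ = λ i vanishes → proj₂ (tight i) (q-p≡0⇒p≡q (trans (sym (value i)) vanishes))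
    ; ∈⇒zero = λ i i∈F → trans (value i) (p≡q⇒q-p≡0 (proj₁ (tight i) i∈F))
    }
    where
    q : Poly
    q = β ∷ map -_ (coefficients d h)
    value : ∀ (i : Fin n) → evalP q (point i) ≡ β - pairing {n} {d} h i
    value i = cong (β +_) (begin
      point i * evalP (map -_ (coefficients d h)) (point i) ≡⟨ cong (point i *_) (evalP-map-neg (coefficients d h) (point i)) ⟩
      point i * - evalP (coefficients d h) (point i)      ≡⟨ neg-distribʳ-* (point i) (evalP (coefficients d h) (point i)) ⟨
      - (point i * evalP (coefficients d h) (point i))    ≡⟨ cong -_ (pairing≡evalP {n} {d} h i) ⟨
      - pairing {n} {d} h i                               ∎)
      where open ≡-Reasoning

  headP : Poly → ℚ
  headP []      = 0ℚ
  headP (c ∷ p) = c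

  tailP : Poly → Poly
  tailP []      = []
  tailP (c ∷ p) = p

  coefficient : Poly → ℕ → ℚ
  coefficient []      k       = 0ℚ
  coefficient (c ∷ p) zero    = c
  coefficient (c ∷ p) (suc k) = coefficient p k

  length-tailP : ∀ p → length (tailP p) ℕ.≤ length p ℕ.∸ 1
  length-tailP []      = z≤n
  length-tailP (c ∷ p) = ℕ.≤-refl

  evalP-head-tail : ∀ p t → evalP p t ≡ headP p + t * evalP (tailP p) t
  evalP-head-tail []      t = sym (trans (+-identityˡ _) (*-zeroʳ t))
  evalP-head-tail (c ∷ p) t = refl

  coefficients-neg : ∀ d p t → length p ℕ.≤ d → evalP (coefficients d (λ j → - coefficient p (toℕ j))) t ≡ - evalP p t
  coefficients-neg zero    []      t _ = refl
  coefficients-neg (suc d) []      t _ =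
    trans (cong (λ z → 0ℚ + t * z) (coefficients-neg d [] t z≤n)) (cong (0ℚ +_) (*-zeroʳ t))
  coefficients-neg (suc d) (c ∷ p) t (s≤s len) rewrite coefficients-neg d p t len =
    solve 3 (λ c t e → (:- c) :+ t :* (:- e) := :- (c :+ t :* e)) refl c t (evalP p t)

  separating⇒face : ∀ d n F → SeparatingPolynomial d n F → IsPolytopeFace d n F
  separating⇒face d n F sep = h , β , below , tight
    where
    open SeparatingPolynomial sep
    β : ℚ
    β = headP poly
    h : Fin d → ℚ
    h j = - coefficient (tailP poly) (toℕ j)
    length-tail : length (tailP poly) ℕ.≤ d
    length-tail = ℕ.≤-trans (length-tailP poly) (ℕ.∸-monoˡ-≤ 1 degree)
    value : ∀ (i : Fin n) → pairing {n} {d} h i ≡ β - evalP poly (point i)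
    value i = begin
      pairing {n} {d} h i                                ≡⟨ pairing≡evalP {n} {d} h i ⟩
      point i * evalP (coefficients d h) (point i)
        ≡⟨ cong (point i *_) (coefficients-neg d (tailP poly) (point i) length-tail) ⟩
      point i * - evalP (tailP poly) (point i)
        ≡⟨ solve 3 (λ b t e → t :* (:- e) := b :- (b :+ t :* e)) refl β (point i) (evalP (tailP poly) (point i)) ⟩
      β - (β + point i * evalP (tailP poly) (point i))   ≡⟨ cong (λ z → β - z) (sym (evalP-head-tail poly (point i))) ⟩
      β - evalP poly (point i)                           ∎
      where open ≡-Reasoning
    below : ∀ i → pairing {n} {d} h i ≤ β
    below i = subst (_≤ β) (sym (value i))
      (0≤q-p⇒p≤q (subst (0ℚ ≤_) (solve 2 (λ b p → p := b :- (b :- p)) refl β (evalP poly (point i))) (nonneg i)))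
    zero-at : ∀ i → pairing {n} {d} h i ≡ β → evalP poly (point i) ≡ 0ℚ
    zero-at i eq = begin
      evalP poly (point i)              ≡⟨ solve 2 (λ b p → p := b :- (b :- p)) refl β (evalP poly (point i)) ⟩
      β - (β - evalP poly (point i))    ≡⟨ cong (λ z → β - z) (trans (sym (value i)) eq) ⟩
      β - β                             ≡⟨ +-inverseʳ β ⟩
      0ℚ                                ∎
      where open ≡-Reasoning
    tight : ∀ i → (i ∈ₛ F → pairing {n} {d} h i ≡ β) × (pairing {n} {d} h i ≡ β → i ∈ₛ F)
    tight i = (λ i∈F → trans (value i) (trans (cong (λ z → β - z) (∈⇒zero i i∈F))
                                               (solve 1 (λ b → b :- con 0ℚ := b) refl β)))
            , (λ eq → zero⇒∈ i (zero-at i eq))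

  module AtPoints {d n F} (sep : SeparatingPolynomial d n F) where
    open SeparatingPolynomial sep

    value-at : ∀ u (u<n : u ℕ.< n) → evalP poly (ι (suc u)) ≡ evalP poly (point (fromℕ< u<n))
    value-at u u<n = cong (λ k → evalP poly (ι (suc k))) (sym (toℕ-fromℕ< u<n))

    nonneg-at : ∀ u → u ℕ.< n → 0ℚ ≤ evalP poly (ι (suc u))
    nonneg-at u u<n = subst (0ℚ ≤_) (sym (value-at u u<n)) (nonneg (fromℕ< u<n))

    zero-at : ∀ u → u ℕ.< n → member F u ≡ true → evalP poly (ι (suc u)) ≡ 0ℚ
    zero-at u u<n u∈F = trans (value-at u u<n)
      (∈⇒zero (fromℕ< u<n) (member⇒∈ F (fromℕ< u<n) (trans (cong (member F) (toℕ-fromℕ< u<n)) u∈F)))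

    zero⇒member : ∀ u (u<n : u ℕ.< n) → evalP poly (ι (suc u)) ≡ 0ℚ → member F u ≡ true
    zero⇒member u u<n vanishes = trans (cong (member F) (sym (toℕ-fromℕ< u<n)))
      (∈⇒member F (fromℕ< u<n) (zero⇒∈ (fromℕ< u<n) (trans (sym (value-at u u<n)) vanishes)))

    positive-at : ∀ u → member F u ≡ false → 0ℚ < evalP poly (ι (suc u))
    positive-at u free = 0≤p∧p≢0⇒0<p (nonneg-at u u<n)
      (λ vanishes → case trans (sym (zero⇒member u u<n vanishes)) free of λ ())
      where
      u<n : u ℕ.< n
      u<n = free⇒< F u free

  -- The face roots give a polynomial ± ∏ (t − r) of degree n − runs that vanishes exactly on P
  -- and has the same sign at all free points.
  runs⇒separating : ∀ d m n x (P : Subset n) → n ≡ d ℕ.+ m → m ℕ.≤ runs x P → SeparatingPolynomial d n P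
  runs⇒separating d m n x P n≡d+m m≤runs = record
    { poly   = poly
    ; degree = ℕ.≤-trans (length-mulRoots R (signed σ 1ℚ ∷ [])) (s≤s length-R)
    ; nonneg = nonneg
    ; zero⇒∈ = λ i vanishes → member⇒∈ P i (zero⇒member (toℕ i) vanishes)
    ; ∈⇒zero = λ i i∈P → zero-at (toℕ i) (∈⇒member P i i∈P) (toℕ<n i)
    }
    where
    R : List ℕ
    R = faceRoots x P
    σ : Bool
    σ = faceRootsSign x P
    poly : Poly
    poly = mulRoots R (signed σ 1ℚ ∷ [])
    length-R : length R ℕ.≤ d
    length-R = ℕ.+-cancelʳ-≤ m (length R) d
      (ℕ.≤-trans (ℕ.+-monoʳ-≤ (length R) m≤runs) (ℕ.≤-reflexive (trans (length-faceRoots x P) n≡d+m)))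
    value : ∀ u → evalP poly (ι (suc u)) ≡ signed σ (rootProduct R (ι (suc u)))
    value u = trans (evalP-mulRoots R (signed σ 1ℚ ∷ []) (ι (suc u)))
      (trans (cong (λ z → rootProduct R (ι (suc u)) * (signed σ 1ℚ + z)) (*-zeroʳ (ι (suc u)))) (signed-1 σ _))
    zero-at : ∀ u → member P u ≡ true → u ℕ.< n → evalP poly (ι (suc u)) ≡ 0ℚ
    zero-at u u∈P u<n = trans (value u) (trans (cong (signed σ) (rootProduct-root u R (P⊆faceRoots x P u u∈P u<n))) (signed-0 σ))
    positive-at : ∀ u → member P u ≡ false → 0ℚ < evalP poly (ι (suc u))
    positive-at u free =
      subst (0ℚ <_) (sym (trans (value u) (cong (λ s → signed s (rootProduct R (ι (suc u)))) (sym (faceRoots-sign x P u free)))))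
      (rootProduct-sign u R (λ u∈R → case trans (sym (faceRoots⊆P x P u u∈R)) free of λ ()))
    nonneg : ∀ (i : Fin n) → 0ℚ ≤ evalP poly (point i)
    nonneg i with member P (toℕ i) in membership
    ... | true  = ≤-reflexive (sym (zero-at (toℕ i) membership (toℕ<n i)))
    ... | false = <⇒≤ (positive-at (toℕ i) membership)
    zero⇒member : ∀ u → evalP poly (ι (suc u)) ≡ 0ℚ → member P u ≡ true
    zero⇒member u vanishes with member P u in membership
    ... | true  = refl
    ... | false = ⊥-elim (<-irrefl (sym vanishes) (positive-at u membership))

  -- If runs < m, multiplying the separating polynomial by the product over the flip roots gives
  -- a polynomial of degree < n − 1 whose values at 1, …, n weakly alternate in sign; so it
  -- vanishes at all of them, which fails at the last free position.
  runs<m⇒¬separating : ∀ d m N x (P : Subset (suc N)) → suc N ≡ d ℕ.+ m → runs x P ℕ.< m → P ≢ ⊤ →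
    SeparatingPolynomial d (suc N) P → ⊥
  runs<m⇒¬separating d m N x P N+1≡d+m runs<m P≢⊤ sep = <-irrefl (sym witness-vanishes) witness-positive
    where
    open SeparatingPolynomial sep using (poly; degree)
    open AtPoints sep using (nonneg-at; zero-at; positive-at)
    first-free : Σ Gen λ y → firstFree x P ≡ just y
    first-free = let u₀ , free₀ = ≢⊤⇒free P P≢⊤ in firstFree-exists x P u₀ free₀
    Y : List ℕ
    Y = flipRoots x P
    σ : Bool
    σ = flipRootsSign x P
    Q : Poly
    Q = mulRoots Y poly
    length-Y : length Y ℕ.+ 1 ≡ runs x P
    length-Y = subst (λ f → length Y ℕ.+ (if is-just f then 1 else 0) ≡ runs x P) (proj₂ first-free) (length-flipRoots x P)
    degree-Q : length Q ℕ.≤ N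
    degree-Q = begin
      length Q                      ≤⟨ length-mulRoots Y poly ⟩
      length poly ℕ.+ length Y      ≤⟨ ℕ.+-monoˡ-≤ (length Y) degree ⟩
      suc d ℕ.+ length Y            ≡⟨ ℕ.+-suc d (length Y) ⟨
      d ℕ.+ suc (length Y)          ≡⟨ cong (d ℕ.+_) (trans (ℕ.+-comm 1 (length Y)) length-Y) ⟩
      d ℕ.+ runs x P                ≤⟨ ℕ.≤-pred (subst (d ℕ.+ runs x P ℕ.<_) (sym N+1≡d+m) (ℕ.+-monoʳ-< d runs<m)) ⟩
      N                             ∎
      where open ℕ.≤-Reasoning
    value : ∀ u → evalP Q (ι (suc u)) ≡ rootProduct Y (ι (suc u)) * evalP poly (ι (suc u))
    value u = evalP-mulRoots Y poly (ι (suc u))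
    sign-at : ∀ u → member P u ≡ false → ¬ (u ∈ Y) → σ xor isEven (suc u) ≡ isEven (countAbove u Y)
    sign-at u free u∉Y = isEven-+⇒xor u (countAbove u Y) σ (flipRoots-sign x P u free u∉Y)
    alternates : AlternatesFrom σ Q 1 N
    alternates u u≤N with member P u in membership | u ∈? Y
    ... | true  | _ = signed-vanishing (σ xor isEven (suc u))
      (trans (value u) (trans (cong (∏ *_) (zero-at u (s≤s u≤N) membership)) (*-zeroʳ ∏)))
      where
      ∏ : ℚ
      ∏ = rootProduct Y (ι (suc u))
    ... | false | yes u∈Y = signed-vanishing (σ xor isEven (suc u))
      (trans (value u) (trans (cong (_* q) (rootProduct-root u Y u∈Y)) (*-zeroˡ q)))
      where
      q : ℚ
      q = evalP poly (ι (suc u))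
    ... | false | no u∉Y =
      subst (0ℚ ≤_) (sym signs) (nonNeg*nonNeg (<⇒≤ (rootProduct-sign u Y u∉Y)) (nonneg-at u (s≤s u≤N)))
      where
      ∏ q : ℚ
      ∏ = rootProduct Y (ι (suc u))
      q = evalP poly (ι (suc u))
      signs : signed (σ xor isEven (suc u)) (evalP Q (ι (suc u))) ≡ signed (isEven (countAbove u Y)) ∏ * q
      signs = trans (cong (signed (σ xor isEven (suc u))) (value u))
                    (trans (signed-*ʳ (σ xor isEven (suc u)) ∏ q) (cong (λ s → signed s ∏ * q) (sign-at u membership u∉Y)))
    witness : Σ ℕ λ u → member P u ≡ false × ¬ (u ∈ Y)
    witness = free∉flipRoots x P (proj₁ first-free) (proj₂ first-free)
    w : ℕ
    w = proj₁ witness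
    s : Bool
    s = isEven (countAbove w Y)
    witness-vanishes : signed s (evalP Q (ι (suc w))) ≡ 0ℚ
    witness-vanishes = trans (cong (signed s) (alternating⇒vanishing N Q σ degree-Q alternates w
                                                                      (ℕ.≤-pred (free⇒< P w (proj₁ (proj₂ witness))))))
                             (signed-0 s)
    witness-positive : 0ℚ < signed s (evalP Q (ι (suc w)))
    witness-positive = subst (0ℚ <_) (sym (trans (cong (signed s) (value w)) (signed-*ʳ s _ _)))
      (pos*pos (rootProduct-sign w Y (proj₂ (proj₂ witness))) (positive-at w (proj₁ (proj₂ witness))))

  boundaryFace⇒m≤runs : ∀ d m n x (P : Subset n) → n ≡ d ℕ.+ m → CyclicBoundaryFace d n P → m ℕ.≤ runs x P
  boundaryFace⇒m≤runs d m zero    x Vec.[] _     (_ , []≢⊤) = ⊥-elim ([]≢⊤ refl)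
  boundaryFace⇒m≤runs d m (suc N) x P  n≡d+m (face , P≢⊤) with m ℕ.≤? runs x P
  ... | yes m≤runs = m≤runs
  ... | no  m≰runs =
    ⊥-elim (runs<m⇒¬separating d m N x P n≡d+m (ℕ.≰⇒> m≰runs) P≢⊤ (face⇒separating d (suc N) P face))

  m≤runs⇒boundaryFace : ∀ d m n x (P : Subset n) → n ≡ d ℕ.+ m → 1 ℕ.≤ m → m ℕ.≤ runs x P →
    CyclicBoundaryFace d n P
  m≤runs⇒boundaryFace d m n x P n≡d+m 1≤m m≤runs =
    separating⇒face d n P (runs⇒separating d m n x P n≡d+m m≤runs) , P≢⊤
    where
    P≢⊤ : P ≢ ⊤
    P≢⊤ P≡⊤ = ℕ.<-irrefl refl (ℕ.<-≤-trans 1≤m (subst (m ℕ.≤_) (runs-⊤ x P P≡⊤) m≤runs))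

open import Defs
open Dihedral
  using (other; other-involutive; alternating; length-alternating; alternating-noRepeat; reduced-w∘⁺; reduced-w∘⁻; coxeterWord)
open GreedySubwords using (subwordFace⇒m≤greedy; m≤greedy⇒subwordFace)
open AlternatingWords using (greedy≡runs)
open CyclicPolytope using (boundaryFace⇒m≤runs; m≤runs⇒boundaryFace)
open import Data.Nat using (ℕ; zero; suc; _+_; _*_; _≤_; _<_; z≤n; s≤s; _%_)
open import Data.Nat.Properties using (<-irrefl; <-asym; m≤n⇒m<n∨m≡n; suc-injective; n<1+n; *-suc; +-comm; ≤-trans)
open import Data.Nat.DivMod using (m%n<n; [m+n]%n≡m%n)
open import Data.Product using (∃; _×_; _,_; proj₁)
open import Data.Sum using (_⊎_; inj₁; inj₂; [_,_]′)
open import Data.List using (List; []; _∷_; length; map)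
open import Data.List.Properties using (length-map)
import Data.List as List
open import Data.List.Relation.Unary.Linked using (Linked; []; [-]; _∷_)
open import Data.Vec.Properties using (tabulate∘lookup)
open import Data.Fin.Properties using (fromℕ<-cong)
open import Function.Properties.Inverse using (↔-refl)
open import Data.Unit using (⊤; tt)
open import Data.Empty using (⊥; ⊥-elim)
open import Relation.Binary.PropositionalEquality

cyc-period : ∀ x y i → cyc (x ∷ y ∷ []) (suc (suc i)) ≡ cyc (x ∷ y ∷ []) i
cyc-period x y i = cong (List.lookup (x ∷ y ∷ []))
  (fromℕ<-cong _ _ (trans (cong (_% 2) (+-comm 2 i)) ([m+n]%n≡m%n i 2 ⦃ _ ⦄)) (m%n<n (suc (suc i)) 2) (m%n<n i 2))

cyc-suc : ∀ x s → cyc (x ∷ other x ∷ []) (suc s) ≡ other (cyc (x ∷ other x ∷ []) s)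
cyc-suc x zero          = refl
cyc-suc x (suc zero)    = sym (other-involutive x)
cyc-suc x (suc (suc s)) =
  trans (cyc-period x (other x) (suc s)) (trans (cyc-suc x s) (cong other (sym (cyc-period x (other x) s))))

range : ℕ → ℕ → List ℕ
range s zero    = []
range s (suc L) = s ∷ range (suc s) L

range-increasing : ∀ s L → Linked _<_ (range s L)
range-increasing s zero          = []
range-increasing s (suc zero)    = [-]
range-increasing s (suc (suc L)) = n<1+n s ∷ range-increasing (suc s) (suc L)

cyc-range : ∀ x s L → map (cyc (x ∷ other x ∷ [])) (range s L) ≡ alternating (cyc (x ∷ other x ∷ []) s) L
cyc-range x s zero    = refl
cyc-range x s (suc L) =
  cong (cyc (x ∷ other x ∷ []) s ∷_) (trans (cyc-range x (suc s) L) (cong (λ y → alternating y L) (cyc-suc x s)))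

HeadAtLeast : ℕ → List ℕ → Set
HeadAtLeast s []      = ⊤
HeadAtLeast s (q ∷ _) = s ≤ q

range-lexMin : ∀ s L qs → Linked _<_ qs → HeadAtLeast s qs → length qs ≡ L →
  range s L ≡ qs ⊎ LexLt (range s L) qs
range-lexMin s zero    []       _          _   _   = inj₁ refl
range-lexMin s (suc L) (q ∷ qs) increasing s≤q len with m≤n⇒m<n∨m≡n s≤q
... | inj₁ s<q  = inj₂ (here s<q)
... | inj₂ refl with range-lexMin (suc s) L qs (tail increasing) (head increasing) (suc-injective len)
  where
  tail : ∀ {q qs} → Linked _<_ (q ∷ qs) → Linked _<_ qs
  tail [-]      = []
  tail (_ ∷ ls) = ls
  head : ∀ {qs} → Linked _<_ (s ∷ qs) → HeadAtLeast (suc s) qs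
  head [-]      = tt
  head (s<q ∷ _) = s<q
...   | inj₁ eq = inj₁ (cong (s ∷_) eq)
...   | inj₂ lt = inj₂ (there lt)

LexLt-asym : ∀ {ps qs} → LexLt ps qs → LexLt qs ps → ⊥
LexLt-asym (here p<q)  (here q<p)  = <-asym p<q q<p
LexLt-asym (here p<p)  (there _)   = <-irrefl refl p<p
LexLt-asym (there _)   (here p<p)  = <-irrefl refl p<p
LexLt-asym (there lt)  (there gt)  = LexLt-asym lt gt

IsW∘cPos-unique : ∀ m cw ps qs → IsW∘cPos m cw ps → IsW∘cPos m cw qs → ps ≡ qs
IsW∘cPos-unique m cw ps qs (valid-ps , least-ps) (valid-qs , least-qs) with least-ps qs valid-qs | least-qs ps valid-ps
... | inj₁ eq | _       = eq
... | inj₂ _  | inj₁ eq = sym eq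
... | inj₂ lt | inj₂ gt = ⊥-elim (LexLt-asym lt gt)

-- Since c c c ⋯ is itself alternating, w∘(c) is its prefix of length m.
w∘c-positions : ∀ m → 1 ≤ m → ∀ x → IsW∘cPos m (x ∷ other x ∷ []) (range 0 m)
w∘c-positions m 1≤m x = valid , least
  where
  valid : ValidW∘Pos m (x ∷ other x ∷ []) (range 0 m)
  valid = range-increasing 0 m ,
    subst (λ w → Reduced m w (w∘ m)) (sym (cyc-range x 0 m))
          (reduced-w∘⁺ m 1≤m (alternating x m) (alternating-noRepeat x m) (length-alternating x m))
  least : ∀ qs → ValidW∘Pos m (x ∷ other x ∷ []) qs → range 0 m ≡ qs ⊎ LexLt (range 0 m) qs
  least qs (increasing , reduced) = range-lexMin 0 m qs increasing (head≥0 qs)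
    (trans (sym (length-map (cyc (x ∷ other x ∷ [])) qs))
           (proj₁ (reduced-w∘⁻ m 1≤m (map (cyc (x ∷ other x ∷ [])) qs) reduced)))
    where
    head≥0 : ∀ qs → HeadAtLeast 0 qs
    head≥0 []       = tt
    head≥0 (q ∷ qs) = z≤n

multiClusterWord-alternating : ∀ x k m →
  multiClusterWord k (x ∷ other x ∷ []) (range 0 m) ≡ alternating x (2 * k + m)
multiClusterWord-alternating x zero    m = cyc-range x 0 m
multiClusterWord-alternating x (suc k) m = begin
  x ∷ other x ∷ multiClusterWord k (x ∷ other x ∷ []) (range 0 m)
    ≡⟨ cong (λ w → x ∷ other x ∷ w) (multiClusterWord-alternating x k m) ⟩
  x ∷ other x ∷ alternating x (2 * k + m)
    ≡⟨ cong (λ y → x ∷ other x ∷ alternating y (2 * k + m)) (sym (other-involutive x)) ⟩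
  alternating x (suc (suc (2 * k + m)))
    ≡⟨ cong (λ n → alternating x (n + m)) (sym (*-suc 2 k)) ⟩
  alternating x (2 * suc k + m) ∎
  where open ≡-Reasoning

-- On the alternating word of length d + m both complexes are described by m ≤ runs, so the
-- identity on positions is an isomorphism.
alternating-iso : ∀ x n d m → n ≡ d + m → 1 ≤ m →
  SCIso {length (alternating x n)} {length (alternating x n)}
        (SubwordFace m (alternating x n) (w∘ m)) (CyclicBoundaryFace d (length (alternating x n)))
alternating-iso x n d m n≡d+m 1≤m = ↔-refl , λ P → to P , from P
  where
  Q : Word
  Q = alternating x n
  length-Q : length Q ≡ d + m
  length-Q = trans (length-alternating x n) n≡d+m
  image-id : ∀ P → image {length Q} ↔-refl P ≡ P
  image-id P = tabulate∘lookup P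
  to : ∀ P → SubwordFace m Q (w∘ m) P → CyclicBoundaryFace d (length Q) (image ↔-refl P)
  to P face = subst (CyclicBoundaryFace d (length Q)) (sym (image-id P))
    (m≤runs⇒boundaryFace d m (length Q) x P length-Q 1≤m
      (subst (m ≤_) (greedy≡runs x n P) (subwordFace⇒m≤greedy m 1≤m Q P face)))
  from : ∀ P → CyclicBoundaryFace d (length Q) (image ↔-refl P) → SubwordFace m Q (w∘ m) P
  from P face = m≤greedy⇒subwordFace m 1≤m Q P (subst (m ≤_) (sym (greedy≡runs x n P))
    (boundaryFace⇒m≤runs d m (length Q) x P length-Q (subst (CyclicBoundaryFace d (length Q)) (image-id P) face)))

MultiClusterIso : ℕ → ℕ → Word → Set
MultiClusterIso m k cw =
  (∃ λ ps → IsW∘cPos m cw ps) ×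
  (∀ ps → IsW∘cPos m cw ps →
    SCIso {length (multiClusterWord k cw ps)} {2 * k + m}
          (SubwordFace m (multiClusterWord k cw ps) (w∘ m)) (CyclicBoundaryFace (2 * k) (2 * k + m)))

multiClusterIso : ∀ m → 1 ≤ m → ∀ k x → MultiClusterIso m k (x ∷ other x ∷ [])
multiClusterIso m 1≤m k x = (range 0 m , w∘c-positions m 1≤m x) , λ ps is-w∘c →
  subst (λ qs → SCIso {length (multiClusterWord k cw qs)} {2 * k + m}
                      (SubwordFace m (multiClusterWord k cw qs) (w∘ m)) (CyclicBoundaryFace (2 * k) (2 * k + m)))
        (IsW∘cPos-unique m cw (range 0 m) ps (w∘c-positions m 1≤m x) is-w∘c)
  (subst (λ Q → SCIso {length Q} {2 * k + m} (SubwordFace m Q (w∘ m)) (CyclicBoundaryFace (2 * k) (2 * k + m)))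
         (sym (multiClusterWord-alternating x k m))
  (subst (λ L → SCIso {length Q} {L} (SubwordFace m Q (w∘ m)) (CyclicBoundaryFace (2 * k) L))
         (length-alternating x (2 * k + m))
         (alternating-iso x (2 * k + m) (2 * k) m refl 1≤m)))
  where
  cw : Word
  cw = x ∷ other x ∷ []
  Q : Word
  Q = alternating x (2 * k + m)

theorem6p1 : ∀ (m : ℕ) → 2 ≤ m → ∀ (k : ℕ) → 1 ≤ k →
    ∀ (c : Elem) → IsCoxeterElement m c →
    ∀ (cw : Word) → Reduced m cw c →
    (∃ λ ps → IsW∘cPos m cw ps) ×
    (∀ ps → IsW∘cPos m cw ps →
    SCIso {length (multiClusterWord k cw ps)} {2 * k + m}
    (SubwordFace m (multiClusterWord k cw ps) (w∘ m))
    (CyclicBoundaryFace (2 * k) (2 * k + m)))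
theorem6p1 m 2≤m k _ c coxeter cw reduced =
  [ (λ cw≡ab → subst (MultiClusterIso m k) (sym cw≡ab) (multiClusterIso m 1≤m k 𝐚))
  , (λ cw≡ba → subst (MultiClusterIso m k) (sym cw≡ba) (multiClusterIso m 1≤m k 𝐛))
  ]′ (coxeterWord m 2≤m c coxeter cw reduced)
  where
  1≤m : 1 ≤ m
  1≤m = ≤-trans (s≤s z≤n) 2≤m
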